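{- Let $\bm{\lambda}=(\lambda^{(1)},\ldots,\lambda^{(k)})$ be a tuple of partitions each with $n$ non-negative parts, $M$ an integer with $\max_a\lambda^{(a)}_1+n-1<M$, and $N=M-n$. For $T=(T^{(1)},\ldots,T^{(k)})$ a semistandard tableau of shape $\bm\lambda$ with entries in $[n]$, let $\Phi(T)=(\Phi(T^{(k)}),\ldots,\Phi(T^{(1)}))$, where for a single tableau $S$ of shape $\mu$ with columns $\nu^1,\ldots,\nu^N$ (left to right, possibly empty, viewed as sets of entries), $\Phi(S)$ is the tableau whose columns from left to right are $\widetilde\nu^N,\ldots,\widetilde\nu^1$, with $\widetilde\nu^i=[n]\setminus\nu^i$ arranged increasingly from bottom to top (so $\Phi(T)$ has shape $\bm\lambda^c=(\lambda^{(k),c},\ldots,\lambda^{(1),c})$, $\lambda^{(a),c}_i=N-\lambda^{(a)}_{n+1-i}$). Then $\mathrm{coinv}(T)-\mathrm{coinv}(\Phi(T))$ does not depend on $T$, and equals $(k-1)|\bm\lambda|-n(M-n)\binom k2$, where $|\bm\lambda|=\sum_{a,i}\lambda^{(a)}_i$.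
   Context: Cells $(r,c)\in\mathbb{Z}^2$ (row, column, rows numbered bottom to top); a partition $\mu$ with $n$ parts consists of cells $(r,c)$, $1\le r\le n$, $1\le c\le\mu_r$; content of $(r,c)$ is $c-r$. Semistandard tableaux have entries weakly increasing along rows and strictly increasing up columns. For a tuple of tableaux $T$ of shape $\bm\mu=(\mu^{(1)},\ldots,\mu^{(k)})$ (each with $n$ parts), a triple is $(u,v,w)$ with, for some $a<b$, $v$ a cell of $\mu^{(a)}$, $u=(r,c-1)$, $w=(r,c)$, $1\le r\le n$, $w$ of the same content as $v$, $c\ge1$, $c\le\mu^{(b)}_r+1$. With $b'$ the entry of $v$, $a'$ the entry of $u$ in $T^{(b)}$ (or $0$ if $u\notin\mu^{(b)}$), $c'$ the entry of $w$ in $T^{(b)}$ (or $\infty$ if $w\notin\mu^{(b)}$), it is a coinversion triple if $a'\le b'\le c'$; $\mathrm{coinv}(T)$ is their number. -}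

module Defs where

open import Data.Bool using (Bool; true; false; _∧_; not; if_then_else_)
open import Data.Nat using (ℕ; zero; suc; _+_; _*_; _∸_; _≤_; _<_; _≤ᵇ_; _<ᵇ_; _≡ᵇ_)
open import Data.Fin using (Fin; toℕ; opposite)
open import Data.List using (List; []; _∷_; map; concatMap; upTo; allFin; filterᵇ)
open import Data.Nat.ListAction using (sum)
open import Data.Bool.ListAction using (any)
open import Data.Product using (_×_; _,_)
open import Data.Integer as ℤ using (ℤ; +_)
open import Data.Nat.Combinatorics using (_C_)

-- Conventions: rows are indexed by Fin n, the 0-based index i standing for
-- row r = toℕ i + 1 (rows numbered bottom to top). Columns are 1-based ℕ.
-- A shape with n parts is  μ : Fin n → ℕ  (μ i = μ_{toℕ i + 1}).
-- A tableau is  Tab n = Fin n → ℕ → ℕ  (row, column ↦ entry); only its values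
-- on cells of the shape are relevant.

Tab : ℕ → Set
Tab n = Fin n → ℕ → ℕ

IsPartition : ∀ {n} → (Fin n → ℕ) → Set
IsPartition {n} μ = ∀ (i j : Fin n) → toℕ i ≤ toℕ j → μ j ≤ μ i

IsSSYT : ∀ {n} → (Fin n → ℕ) → Tab n → Set
IsSSYT {n} μ S =
  (∀ (i : Fin n) (c : ℕ) → 1 ≤ c → c ≤ μ i → 1 ≤ S i c × S i c ≤ n)
  × (∀ (i : Fin n) (c : ℕ) → 1 ≤ c → suc c ≤ μ i → S i c ≤ S i (suc c))
  × (∀ (i j : Fin n) → toℕ j ≡ suc (toℕ i) → ∀ (c : ℕ) → 1 ≤ c → c ≤ μ j
       → S i c < S j c)
  where open import Relation.Binary.PropositionalEquality using (_≡_)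

range1 : ℕ → List ℕ
range1 m = map suc (upTo m)

cells : ∀ {n} → (Fin n → ℕ) → List (Fin n × ℕ)
cells {n} μ = concatMap (λ i → map (λ c → (i , c)) (range1 (μ i))) (allFin n)

inShape : ∀ {n} → (Fin n → ℕ) → Fin n → ℕ → Bool
inShape μ i c = (1 ≤ᵇ c) ∧ (c ≤ᵇ μ i)

⟦_⟧ : Bool → ℕ
⟦ b ⟧ = if b then 1 else 0

-- Number of coinversion triples with v = (iv , cv) a cell of μ^(a) = μa,
-- and u , w in row i, relative to μ^(b) = μb and tableau T^(b) = Tb.
-- Here b' = Ta iv cv;  w = (i , c) with c = cv + r - rv (same content as v),
-- u = (i , c - 1); a' = 0 if u ∉ μb, c' = ∞ if w ∉ μb.
isCoinvTriple : ∀ {n} → (Fin n → ℕ) → Tab n → (Fin n → ℕ) → Tab n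
              → Fin n → ℕ → Fin n → Bool
isCoinvTriple μa Ta μb Tb iv cv i =
  let c  = cv + toℕ i ∸ toℕ iv
      b' = Ta iv cv
      a' = if inShape μb i (c ∸ 1) then Tb i (c ∸ 1) else 0
      okc = if inShape μb i c then b' ≤ᵇ Tb i c else true
  in (toℕ iv <ᵇ cv + toℕ i)          -- c ≥ 1
     ∧ (c ≤ᵇ suc (μb i))
     ∧ (a' ≤ᵇ b') ∧ okc

coinv : ∀ {k n} → (Fin k → Fin n → ℕ) → (Fin k → Tab n) → ℕ
coinv {k} {n} μ T =
  sum (concatMap (λ a → concatMap (λ b →
        if toℕ a <ᵇ toℕ b
        then concatMap (λ v → map (λ i →
               ⟦ isCoinvTriple (μ a) (T a) (μ b) (T b) (Data.Product.proj₁ v) (Data.Product.proj₂ v) i ⟧)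
               (allFin n)) (cells (μ a))
        else []) (allFin k)) (allFin k))
  where import Data.Product

-- r-th element (0-based) of a list, default 0
nth : List ℕ → ℕ → ℕ
nth []       _       = 0
nth (x ∷ xs) zero    = x
nth (x ∷ xs) (suc r) = nth xs r

inColumn : ∀ {n} → (Fin n → ℕ) → Tab n → ℕ → ℕ → Bool
inColumn {n} μ S j x = any (λ r → (j ≤ᵇ μ r) ∧ (S r j ≡ᵇ x)) (allFin n)

Φ₁ : ∀ {n} → ℕ → (Fin n → ℕ) → Tab n → Tab n
Φ₁ {n} N μ S i c =
  nth (filterᵇ (λ x → not (inColumn μ S (suc N ∸ c) x)) (range1 n)) (toℕ i)

Φ : ∀ {k n} → ℕ → (Fin k → Fin n → ℕ) → (Fin k → Tab n) → (Fin k → Tab n)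
Φ N μ T a = Φ₁ N (μ (opposite a)) (T (opposite a))

complementShape : ∀ {k n} → ℕ → (Fin k → Fin n → ℕ) → (Fin k → Fin n → ℕ)
complementShape N μ a i = N ∸ μ (opposite a) (opposite i)

size : ∀ {k n} → (Fin k → Fin n → ℕ) → ℕ
size {k} {n} μ = sum (concatMap (λ a → map (μ a) (allFin n)) (allFin k))

-- Fix a < b and a cell v of T^(a) with entry x, and follow the diagonal of v's content
-- through T^(b).  The staircase separating the entries < x of T^(b) from those ≥ x is
-- crossed exactly once along this diagonal: either in a row i, where (u, v, w) is a
-- coinversion triple, or at a column not containing x whose insertion point for x sits
-- next to the diagonal (a vacancy).  So the coinversion triples of the pair plus the
-- vacancies number |λ^(a)|.  Complementing and reversing columns turns the vacancies of
-- T^(a) in T^(b) into those of Φ(T^(b)) in Φ(T^(a)); as |λ^(b),c| = nN − |λ^(b)|, each pair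
-- contributes |λ^(a)| + |λ^(b)| − nN to coinv(T) − coinv(Φ(T)), and there are k choose 2 pairs.

module Submission where

open import Data.Bool using (Bool; true; false; _∧_; _∨_; not; if_then_else_; T; T?)
open import Data.Bool.Properties using (∧-assoc; ∧-comm; not-involutive; T-≡; T-∧; T-∨)
open import Data.Empty using (⊥; ⊥-elim)
open import Data.Unit using (tt)
open import Data.Nat
open import Data.Nat.Properties
open import Data.Nat.ListAction using (sum)
open import Data.Nat.ListAction.Properties using (sum-++)
open import Data.Nat.Combinatorics using (_C_; nC1≡n; nCk+nC[k+1]≡[n+1]C[k+1])
open import Data.Fin as Fin using (Fin; toℕ; fromℕ<; opposite)
open import Data.Fin.Properties using (toℕ<n; toℕ-fromℕ<; fromℕ<-toℕ; fromℕ<-cong; opposite-prop; opposite-involutive)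
import Data.Fin.Permutation as Perm
open import Data.List using (List; []; _∷_; _++_; map; concat; concatMap; filterᵇ; length; allFin; tabulate; applyUpTo; upTo)
open import Data.List.Relation.Unary.All as All using (All; []; _∷_)
open import Data.List.Relation.Unary.AllPairs using (AllPairs; []; _∷_)
open import Data.List.Relation.Unary.Any using (here; there; satisfied)
open import Data.List.Membership.Propositional using (_∈_; lose)
open import Data.List.Membership.Propositional.Properties using (∈-filter⁺; ∈-filter⁻; ∈-applyUpTo⁺; ∈-applyUpTo⁻; ∈-allFin)
import Data.List.Relation.Unary.AllPairs.Properties as AllPairs
open import Data.Product using (Σ; _×_; _,_; proj₁; proj₂)
open import Data.Sum using (_⊎_; inj₁; inj₂)
open import Function using (_∘_; id; Equivalence; _⇔_; mk⇔)
open import Relation.Binary.PropositionalEquality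
open import Relation.Nullary using (¬_; Dec; yes; no)
open import Algebra.Properties.Semiring.Sum +-*-semiring
  using (∑-comm; ∑-distrib-+; sum-cong-≗; sum-permute)
  renaming (sum to ∑)
open import Algebra.Properties.CommutativeSemigroup +-commutativeSemigroup using (interchange)
open import Data.Nat.Tactic.RingSolver using (solve-∀)
open import Defs
open import Data.List.Properties using (map-++; length-filter; length-map; length-upTo; length-applyUpTo)
open import Data.List.Relation.Unary.Any.Properties using (any⁺; any⁻)
import Data.List.Relation.Unary.All.Properties as All

sumOver : {A : Set} → (A → ℕ) → List A → ℕ
sumOver f xs = sum (map f xs)

sumOver-cong : {A : Set} {f g : A → ℕ} → (∀ x → f x ≡ g x) → ∀ xs → sumOver f xs ≡ sumOver g xs
sumOver-cong f≗g []       = refl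
sumOver-cong f≗g (x ∷ xs) = cong₂ _+_ (f≗g x) (sumOver-cong f≗g xs)

sumOver-zero : {A : Set} (xs : List A) → sumOver (λ _ → 0) xs ≡ 0
sumOver-zero []       = refl
sumOver-zero (x ∷ xs) = sumOver-zero xs

sumOver-distrib-+ : {A : Set} (f g : A → ℕ) (xs : List A) → sumOver (λ x → f x + g x) xs ≡ sumOver f xs + sumOver g xs
sumOver-distrib-+ f g []       = refl
sumOver-distrib-+ f g (x ∷ xs) =
  trans (cong (f x + g x +_) (sumOver-distrib-+ f g xs)) (interchange (f x) (g x) (sumOver f xs) (sumOver g xs))

sumOver-comm : {A B : Set} (f : A → B → ℕ) (xs : List A) (ys : List B) →
  sumOver (λ x → sumOver (f x) ys) xs ≡ sumOver (λ y → sumOver (λ x → f x y) xs) ys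
sumOver-comm f []       ys = sym (sumOver-zero ys)
sumOver-comm f (x ∷ xs) ys =
  trans (cong (sumOver (f x) ys +_) (sumOver-comm f xs ys))
        (sym (sumOver-distrib-+ (f x) (λ y → sumOver (λ x → f x y) xs) ys))

sumOver-map : {A B : Set} (f : B → ℕ) (g : A → B) (xs : List A) → sumOver f (map g xs) ≡ sumOver (f ∘ g) xs
sumOver-map f g []       = refl
sumOver-map f g (x ∷ xs) = cong (f (g x) +_) (sumOver-map f g xs)

sumOver-concatMap : {A B : Set} (f : B → ℕ) (g : A → List B) (xs : List A) →
  sumOver f (concatMap g xs) ≡ sumOver (λ x → sumOver f (g x)) xs
sumOver-concatMap f g []       = refl
sumOver-concatMap f g (x ∷ xs) =
  trans (sumOver-++ (g x) (concat (map g xs))) (cong (sumOver f (g x) +_) (sumOver-concatMap f g xs))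
  where sumOver-++ : ∀ ys zs → sumOver f (ys ++ zs) ≡ sumOver f ys + sumOver f zs
        sumOver-++ ys zs = trans (cong sum (map-++ f ys zs)) (sum-++ (map f ys) (map f zs))

sum-concatMap : {A : Set} (g : A → List ℕ) (xs : List A) → sum (concatMap g xs) ≡ sumOver (sum ∘ g) xs
sum-concatMap g []       = refl
sum-concatMap g (x ∷ xs) = trans (sum-++ (g x) (concat (map g xs))) (cong (sum (g x) +_) (sum-concatMap g xs))

T-ext : ∀ {a b : Bool} → (T a → T b) → (T b → T a) → a ≡ b
T-ext {false} {false} _ _ = refl
T-ext {false} {true}  _ g = ⊥-elim (g tt)
T-ext {true}  {false} f _ = ⊥-elim (f tt)
T-ext {true}  {true}  _ _ = refl

¬T⇒≡false : ∀ {b} → ¬ T b → b ≡ false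
¬T⇒≡false {false} _ = refl
¬T⇒≡false {true}  f = ⊥-elim (f tt)

<ᵇ-true : ∀ {m n} → m < n → (m <ᵇ n) ≡ true
<ᵇ-true = Equivalence.to T-≡ ∘ <⇒<ᵇ

<ᵇ-false : ∀ {m n} → n ≤ m → (m <ᵇ n) ≡ false
<ᵇ-false n≤m = ¬T⇒≡false λ t → <⇒≱ (<ᵇ⇒< _ _ t) n≤m

≤ᵇ-true : ∀ {m n} → m ≤ n → (m ≤ᵇ n) ≡ true
≤ᵇ-true = Equivalence.to T-≡ ∘ ≤⇒≤ᵇ

≤ᵇ-false : ∀ {m n} → n < m → (m ≤ᵇ n) ≡ false
≤ᵇ-false n<m = ¬T⇒≡false λ t → <⇒≱ n<m (≤ᵇ⇒≤ _ _ t)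

interval : ℕ → ℕ → List ℕ
interval s zero    = []
interval s (suc m) = s ∷ interval (suc s) m

Within : ℕ → ℕ → ℕ → Set
Within s m y = s ≤ y × y < s + m

within-head : ∀ s m → Within s (suc m) s
within-head s m = ≤-refl , m<m+n s z<s

within-tail : ∀ {s m y} → Within (suc s) m y → Within s (suc m) y
within-tail {s} {m} {y} (s<y , y<) = <⇒≤ s<y , subst (y <_) (sym (+-suc s m)) y<

within-empty : ∀ {s y} → ¬ Within s 0 y
within-empty {s} (s≤y , y<s+0) = <⇒≱ y<s+0 (subst (_≤ _) (sym (+-identityʳ s)) s≤y)

within-split : ∀ {s m y} → Within s (suc m) y → y ≡ s ⊎ Within (suc s) m y
within-split {s} {m} {y} (s≤y , y<) with m≤n⇒m<n∨m≡n s≤y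
... | inj₂ refl = inj₁ refl
... | inj₁ s<y  = inj₂ (s<y , subst (y <_) (+-suc s m) y<)

range1≡interval : ∀ m → range1 m ≡ interval 1 m
range1≡interval m = go id 0 m (λ _ → refl)
  where
  go : ∀ (f : ℕ → ℕ) s m → (∀ j → f j ≡ s + j) → map suc (applyUpTo f m) ≡ interval (suc s) m
  go f s zero    f≗ = refl
  go f s (suc m) f≗ = cong₂ _∷_ (cong suc (trans (f≗ 0) (+-identityʳ s))) (go (f ∘ suc) (suc s) m (λ j → trans (f≗ (suc j)) (+-suc s j)))

sumOver-interval-cong : ∀ {f g : ℕ → ℕ} s m → (∀ y → Within s m y → f y ≡ g y) →
  sumOver f (interval s m) ≡ sumOver g (interval s m)
sumOver-interval-cong s zero    f≗g = refl
sumOver-interval-cong s (suc m) f≗g =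
  cong₂ _+_ (f≗g s (within-head s m)) (sumOver-interval-cong (suc s) m (λ y → f≗g y ∘ within-tail))

sumOver-interval-suc : ∀ (f : ℕ → ℕ) s m → sumOver f (interval (suc s) m) ≡ sumOver (f ∘ suc) (interval s m)
sumOver-interval-suc f s zero    = refl
sumOver-interval-suc f s (suc m) = cong (f (suc s) +_) (sumOver-interval-suc f (suc s) m)

sumOver-interval-snoc : ∀ (f : ℕ → ℕ) s m → sumOver f (interval s (suc m)) ≡ sumOver f (interval s m) + f (s + m)
sumOver-interval-snoc f s zero    = trans (+-identityʳ (f s)) (cong f (sym (+-identityʳ s)))
sumOver-interval-snoc f s (suc m) = begin
  f s + sumOver f (interval (suc s) (suc m))             ≡⟨ cong (f s +_) (sumOver-interval-snoc f (suc s) m) ⟩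
  f s + (sumOver f (interval (suc s) m) + f (suc s + m)) ≡⟨ +-assoc (f s) _ _ ⟨
  f s + sumOver f (interval (suc s) m) + f (suc s + m)   ≡⟨ cong (λ z → f s + sumOver f (interval (suc s) m) + f z) (+-suc s m) ⟨
  f s + sumOver f (interval (suc s) m) + f (s + suc m)   ∎
  where open ≡-Reasoning

sumOver-interval-reverse : ∀ (f : ℕ → ℕ) N → sumOver f (interval 1 N) ≡ sumOver (λ c → f (suc N ∸ c)) (interval 1 N)
sumOver-interval-reverse f zero    = refl
sumOver-interval-reverse f (suc N) = begin
  sumOver f (interval 1 (suc N))                                 ≡⟨ sumOver-interval-snoc f 1 N ⟩
  sumOver f (interval 1 N) + f (suc N)                           ≡⟨ cong (_+ f (suc N)) (sumOver-interval-reverse f N) ⟩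
  sumOver (λ c → f (suc N ∸ c)) (interval 1 N) + f (suc N)       ≡⟨ +-comm _ (f (suc N)) ⟩
  f (suc N) + sumOver (λ c → f (suc N ∸ c)) (interval 1 N)       ≡⟨ cong (f (suc N) +_) (sumOver-interval-suc (λ c → f (suc (suc N) ∸ c)) 1 N) ⟨
  f (suc N) + sumOver (λ c → f (suc (suc N) ∸ c)) (interval 2 N) ∎
  where open ≡-Reasoning

sumOver-interval-extend : ∀ (g : ℕ → ℕ) m N → m ≤ N →
  sumOver g (interval 1 m) ≡ sumOver (λ c → if c ≤ᵇ m then g c else 0) (interval 1 N)
sumOver-interval-extend g m N m≤N with m≤n⇒m<n∨m≡n m≤N
... | inj₂ refl = sumOver-interval-cong 1 m λ c (_ , c<1+m) → cong (λ b → if b then g c else 0) (sym (≤ᵇ-true (≤-pred c<1+m)))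
... | inj₁ m<N with N | m<N
...   | suc N′ | s≤s m≤N′ = begin
  sumOver g (interval 1 m)                  ≡⟨ sumOver-interval-extend g m N′ m≤N′ ⟩
  sumOver g≤m (interval 1 N′)               ≡⟨ +-identityʳ _ ⟨
  sumOver g≤m (interval 1 N′) + 0           ≡⟨ cong (λ b → sumOver g≤m (interval 1 N′) + (if b then g (suc N′) else 0)) (≤ᵇ-false (s≤s m≤N′)) ⟨
  sumOver g≤m (interval 1 N′) + g≤m (suc N′) ≡⟨ sumOver-interval-snoc g≤m 1 N′ ⟨
  sumOver g≤m (interval 1 (suc N′))         ∎
  where
  open ≡-Reasoning
  g≤m = λ c → if c ≤ᵇ m then g c else 0

sumOver-allFin : ∀ {n} (f : Fin n → ℕ) → sumOver f (allFin n) ≡ ∑ f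
sumOver-allFin f = go {h = f} id
  where
  go : ∀ {m} {A : Set} {h : A → ℕ} (g : Fin m → A) → sumOver h (tabulate g) ≡ ∑ (h ∘ g)
  go {zero}  g = refl
  go {suc m} {h = h} g = cong (h (g Fin.zero) +_) (go (g ∘ Fin.suc))

∑-cong : ∀ {n} (f g : Fin n → ℕ) → (∀ i → f i ≡ g i) → ∑ f ≡ ∑ g
∑-cong f g f≗g = sum-cong-≗ f≗g

∑-opposite : ∀ {n} (f : Fin n → ℕ) → ∑ (f ∘ opposite) ≡ ∑ f
∑-opposite f = sym (sum-permute f Perm.reverse)

∑-const : ∀ n c → ∑ {n} (λ _ → c) ≡ n * c
∑-const zero    c = refl
∑-const (suc n) c = cong (c +_) (∑-const n c)

∑-toℕ : ∀ n (h : ℕ → ℕ) → ∑ (h ∘ toℕ {n}) ≡ sumOver h (interval 0 n)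
∑-toℕ zero    h = refl
∑-toℕ (suc n) h = cong (h 0 +_) (trans (∑-toℕ n (h ∘ suc)) (sym (sumOver-interval-suc h 0 n)))

sumOver-cells : ∀ {n} (μ : Fin n → ℕ) (f : Fin n × ℕ → ℕ) →
  sumOver f (cells μ) ≡ sumOver (λ i → sumOver (λ c → f (i , c)) (interval 1 (μ i))) (allFin n)
sumOver-cells {n} μ f = trans (sumOver-concatMap f (λ i → map (i ,_) (range1 (μ i))) (allFin n))
  (sumOver-cong (λ i → trans (sumOver-map f (i ,_) (range1 (μ i))) (cong (sumOver (λ c → f (i , c))) (range1≡interval (μ i)))) (allFin n))

number-of-cells : ∀ {n} (μ : Fin n → ℕ) → sumOver (λ _ → 1) (cells μ) ≡ ∑ μ
number-of-cells μ = trans (sumOver-cells μ (λ _ → 1)) (trans (sumOver-cong (λ i → length-interval 1 (μ i)) (allFin _)) (sumOver-allFin μ))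
  where length-interval : ∀ s m → sumOver (λ _ → 1) (interval s m) ≡ m
        length-interval s zero    = refl
        length-interval s (suc m) = cong suc (length-interval (suc s) m)

sumOver-indicator-none : ∀ (p : ℕ → Bool) s m → (∀ y → Within s m y → ¬ T (p y)) →
  sumOver (⟦_⟧ ∘ p) (interval s m) ≡ 0
sumOver-indicator-none p s zero    none = refl
sumOver-indicator-none p s (suc m) none with p s in ps
... | true  = ⊥-elim (none s (within-head s m) (subst T (sym ps) tt))
... | false = sumOver-indicator-none p (suc s) m (λ y → none y ∘ within-tail)

sumOver-indicator-unique : ∀ (p : ℕ → Bool) s m y → Within s m y → T (p y) →
  (∀ z → Within s m z → T (p z) → z ≡ y) → sumOver (⟦_⟧ ∘ p) (interval s m) ≡ 1
sumOver-indicator-unique p s zero    y y∈ py unique = ⊥-elim (within-empty y∈)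
sumOver-indicator-unique p s (suc m) y y∈ py unique with p s in ps
... | true  = cong suc (sumOver-indicator-none p (suc s) m λ z z∈ pz →
                <⇒≢ (proj₁ z∈) (trans (unique s (within-head s m) (subst T (sym ps) tt)) (sym (unique z (within-tail z∈) pz))))
... | false with within-split y∈
...   | inj₁ refl = ⊥-elim (subst T ps py)
...   | inj₂ y∈′  = sumOver-indicator-unique p (suc s) m y y∈′ py (λ z → unique z ∘ within-tail)

count : (ℕ → Bool) → List ℕ → ℕ
count p xs = length (filterᵇ p xs)

rank : ℕ → List ℕ → ℕ
rank x = count (_<ᵇ x)

rank-cons-≥ : ∀ {x y} xs → x ≤ y → rank x (y ∷ xs) ≡ rank x xs
rank-cons-≥ {x} {y} xs x≤y rewrite <ᵇ-false {y} {x} x≤y = refl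

rank-cons-< : ∀ {x y} xs → y < x → rank x (y ∷ xs) ≡ suc (rank x xs)
rank-cons-< {x} {y} xs y<x rewrite <ᵇ-true y<x = refl

Increasing : List ℕ → Set
Increasing = AllPairs _<_

nth-All : ∀ {P : ℕ → Set} {xs} → All P xs → ∀ j → j < length xs → P (nth xs j)
nth-All (px ∷ _)   zero    _         = px
nth-All (_ ∷ pxs)  (suc j) (s≤s j<) = nth-All pxs j j<

rank-≡0 : ∀ x {xs} → All (x ≤_) xs → rank x xs ≡ 0
rank-≡0 x []                    = refl
rank-≡0 x {_ ∷ ys} (x≤y ∷ x≤ys) = trans (rank-cons-≥ ys x≤y) (rank-≡0 x x≤ys)

rank-below-head : ∀ {x y ys} → Increasing (y ∷ ys) → x ≤ y → rank x (y ∷ ys) ≡ 0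
rank-below-head {ys = ys} (y<ys ∷ _) x≤y = rank-≡0 _ (x≤y ∷ All.map (λ y<z → ≤-trans x≤y (<⇒≤ y<z)) y<ys)

≤nth⇒rank≤ : ∀ {xs} → Increasing xs → ∀ j → j < length xs → ∀ x → x ≤ nth xs j → rank x xs ≤ j
≤nth⇒rank≤ {_ ∷ _} xs↑ zero _ x x≤y = ≤-reflexive (rank-below-head xs↑ x≤y)
≤nth⇒rank≤ {y ∷ ys} xs↑@(_ ∷ ys↑) (suc j) (s≤s j<) x x≤ with y <? x
... | yes y<x = subst (_≤ suc j) (sym (rank-cons-< ys y<x)) (s≤s (≤nth⇒rank≤ ys↑ j j< x x≤))
... | no  y≮x = subst (_≤ suc j) (sym (rank-below-head xs↑ (≮⇒≥ y≮x))) z≤n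

rank≤⇒≤nth : ∀ {xs} → Increasing xs → ∀ j → j < length xs → ∀ x → rank x xs ≤ j → x ≤ nth xs j
rank≤⇒≤nth {y ∷ ys} (y<ys ∷ ys↑) j j< x r≤j with y <? x
... | no y≮x = ≤-trans (≮⇒≥ y≮x) (head≤nth j j<)
  where
  head≤nth : ∀ j → j < length (y ∷ ys) → y ≤ nth (y ∷ ys) j
  head≤nth zero    _        = ≤-refl
  head≤nth (suc j) (s≤s j<) = <⇒≤ (nth-All y<ys j j<)
... | yes y<x with j | j<
...   | zero  | _        = ⊥-elim (<⇒≱ z<s (subst (_≤ 0) (rank-cons-< ys y<x) r≤j))
...   | suc j | s≤s j<′ = rank≤⇒≤nth ys↑ j j<′ x (≤-pred (subst (_≤ suc j) (rank-cons-< ys y<x) r≤j))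

count-filter-split : ∀ (q p : ℕ → Bool) xs → count q (filterᵇ (not ∘ p) xs) + count q (filterᵇ p xs) ≡ count q xs
count-filter-split q p []       = refl
count-filter-split q p (x ∷ xs) with p x
... | true with q x
...   | true  = trans (+-suc _ _) (cong suc (count-filter-split q p xs))
...   | false = count-filter-split q p xs
count-filter-split q p (x ∷ xs) | false with q x
...   | true  = cong suc (count-filter-split q p xs)
...   | false = count-filter-split q p xs

length-filter-split : ∀ (p : ℕ → Bool) xs → length (filterᵇ (not ∘ p) xs) + length (filterᵇ p xs) ≡ length xs
length-filter-split p []       = refl
length-filter-split p (x ∷ xs) with p x
... | true  = trans (+-suc _ _) (cong suc (length-filter-split p xs))
... | false = cong suc (length-filter-split p xs)

count-filter-≤ : ∀ (q p : ℕ → Bool) xs → count q (filterᵇ p xs) ≤ count q xs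
count-filter-≤ q p []       = z≤n
count-filter-≤ q p (x ∷ xs) with p x
... | true with q x
...   | true  = s≤s (count-filter-≤ q p xs)
...   | false = count-filter-≤ q p xs
count-filter-≤ q p (x ∷ xs) | false with q x
...   | true  = m≤n⇒m≤1+n (count-filter-≤ q p xs)
...   | false = count-filter-≤ q p xs

rank-interval-≤ : ∀ x s m → rank x (interval s m) ≤ x ∸ s
rank-interval-≤ x s zero    = z≤n
rank-interval-≤ x s (suc m) with s <ᵇ x in s<?x
... | true  = ≤-trans (s≤s (rank-interval-≤ x (suc s) m)) (≤-reflexive (sym (+-∸-assoc 1 (<ᵇ⇒< s x (subst T (sym s<?x) tt)))))
... | false = ≤-trans (rank-interval-≤ x (suc s) m) (∸-monoʳ-≤ x (n≤1+n s))

interval-bounds : ∀ s m → All (Within s m) (interval s m)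
interval-bounds s zero    = []
interval-bounds s (suc m) = within-head s m ∷ All.map within-tail (interval-bounds (suc s) m)

interval-increasing : ∀ s m → Increasing (interval s m)
interval-increasing s zero    = []
interval-increasing s (suc m) = All.map proj₁ (interval-bounds (suc s) m) ∷ interval-increasing (suc s) m

filter-interval-above : ∀ (p : ℕ → Bool) s m → All (s <_) (filterᵇ p (interval (suc s) m))
filter-interval-above p s m = All.filter⁺ (T? ∘ p) (All.map proj₁ (interval-bounds (suc s) m))

rank-filter-interval-suc : ∀ (p : ℕ → Bool) s m y → Within s m y →
  rank (suc y) (filterᵇ p (interval s m)) ≡ rank y (filterᵇ p (interval s m)) + ⟦ p y ⟧
rank-filter-interval-suc p s zero    y y∈ = ⊥-elim (within-empty y∈)
rank-filter-interval-suc p s (suc m) y y∈ with within-split y∈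
... | inj₁ refl with p s
...   | true  rewrite <ᵇ-true (n<1+n s) | <ᵇ-false {s} {s} ≤-refl
                    | rank-≡0 (suc s) (filter-interval-above p s m)
                    | rank-≡0 s (All.map <⇒≤ (filter-interval-above p s m)) = refl
...   | false rewrite rank-≡0 (suc s) (filter-interval-above p s m)
                    | rank-≡0 s (All.map <⇒≤ (filter-interval-above p s m)) = refl
rank-filter-interval-suc p s (suc m) y y∈ | inj₂ y∈′ with p s
...   | true  rewrite <ᵇ-true (<-trans (proj₁ y∈′) (n<1+n y)) | <ᵇ-true (proj₁ y∈′) =
  cong suc (rank-filter-interval-suc p (suc s) m y y∈′)
...   | false = rank-filter-interval-suc p (suc s) m y y∈′

sumWithIndex : (ℕ → ℕ → ℕ) → List ℕ → ℕ → ℕ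
sumWithIndex g []       o = 0
sumWithIndex g (y ∷ ys) o = g y o + sumWithIndex g ys (suc o)

sumOver-positions : ∀ (g : ℕ → ℕ → ℕ) xs o m → length xs ≤ m →
  sumOver (λ j → if j <ᵇ length xs then g (nth xs j) (o + j) else 0) (interval 0 m) ≡ sumWithIndex g xs o
sumOver-positions g []       o m       _        = sumOver-zero (interval 0 m)
sumOver-positions g (y ∷ ys) o (suc m) (s≤s ≤m) = cong₂ _+_ (cong (g y) (+-identityʳ o)) (begin
  sumOver (λ j → if j <ᵇ suc (length ys) then g (nth (y ∷ ys) j) (o + j) else 0) (interval 1 m)
    ≡⟨ sumOver-interval-suc _ 0 m ⟩
  sumOver (λ j → if j <ᵇ length ys then g (nth ys j) (o + suc j) else 0) (interval 0 m)
    ≡⟨ sumOver-cong (λ j → cong (λ z → if j <ᵇ length ys then g (nth ys j) z else 0) (+-suc o j)) (interval 0 m) ⟩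
  sumOver (λ j → if j <ᵇ length ys then g (nth ys j) (suc o + j) else 0) (interval 0 m)
    ≡⟨ sumOver-positions g ys (suc o) m ≤m ⟩
  sumWithIndex g ys (suc o) ∎)
  where open ≡-Reasoning

sumWithIndex-filter-interval : ∀ (g : ℕ → ℕ → ℕ) (p : ℕ → Bool) s m o →
  sumWithIndex g (filterᵇ p (interval s m)) o ≡
  sumOver (λ y → if p y then g y (o + rank y (filterᵇ p (interval s m))) else 0) (interval s m)
sumWithIndex-filter-interval g p s zero    o = refl
sumWithIndex-filter-interval g p s (suc m) o with p s
... | true = cong₂ _+_
  (cong (g s) (sym (trans (cong (o +_) (trans (rank-cons-≥ {s} F ≤-refl) (rank-≡0 s (All.map <⇒≤ (filter-interval-above p s m)))))
                          (+-identityʳ o))))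
  (trans (sumWithIndex-filter-interval g p (suc s) m (suc o))
         (sumOver-interval-cong (suc s) m (λ y (s<y , _) → cong (λ z → if p y then g y z else 0)
            (trans (sym (+-suc o _)) (cong (o +_) (sym (rank-cons-< F s<y)))))))
  where F = filterᵇ p (interval (suc s) m)
... | false = sumWithIndex-filter-interval g p (suc s) m o

∈-interval⁺ : ∀ {s m z} → Within s m z → z ∈ interval s m
∈-interval⁺ {s} {zero}  z∈ = ⊥-elim (within-empty z∈)
∈-interval⁺ {s} {suc m} z∈ with within-split z∈
... | inj₁ refl = here refl
... | inj₂ z∈′  = there (∈-interval⁺ z∈′)

increasing-extensional : ∀ {xs ys} → Increasing xs → Increasing ys →
  (∀ {z} → z ∈ xs → z ∈ ys) → (∀ {z} → z ∈ ys → z ∈ xs) → xs ≡ ys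
increasing-extensional []       []       _   _   = refl
increasing-extensional []       (_ ∷ _)  _   ys⊆ with () ← ys⊆ (here refl)
increasing-extensional (_ ∷ _)  []       xs⊆ _   with () ← xs⊆ (here refl)
increasing-extensional {x ∷ xs} {y ∷ ys} (x<xs ∷ xs↑) (y<ys ∷ ys↑) xs⊆ ys⊆ =
  cong₂ _∷_ x≡y (increasing-extensional xs↑ ys↑ (drop xs⊆ x<xs x≡y) (drop ys⊆ y<ys (sym x≡y)))
  where
  x≡y : x ≡ y
  x≡y with xs⊆ (here refl) | ys⊆ (here refl)
  ... | here x≡y   | _          = x≡y
  ... | there _    | here y≡x   = sym y≡x
  ... | there x∈ys | there y∈xs = ⊥-elim (<-asym (All.lookup y<ys x∈ys) (All.lookup x<xs y∈xs))
  drop : ∀ {u v us vs} → (∀ {z} → z ∈ u ∷ us → z ∈ v ∷ vs) → All (u <_) us → u ≡ v → ∀ {z} → z ∈ us → z ∈ vs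
  drop ⊆ u<us u≡v z∈us with ⊆ (there z∈us)
  ... | here z≡v   = ⊥-elim (<⇒≢ (All.lookup u<us z∈us) (trans u≡v (sym z≡v)))
  ... | there z∈vs = z∈vs

nth-applyUpTo : ∀ (f : ℕ → ℕ) m j → j < m → nth (applyUpTo f m) j ≡ f j
nth-applyUpTo f (suc m) zero    _        = refl
nth-applyUpTo f (suc m) (suc j) (s≤s j<m) = nth-applyUpTo (f ∘ suc) m j j<m

rank-applyUpTo-mono : ∀ x (f g : ℕ → ℕ) {m m′} → m′ ≤ m → (∀ j → j < m′ → f j ≤ g j) →
  rank x (applyUpTo g m′) ≤ rank x (applyUpTo f m)
rank-applyUpTo-mono x f g {m} {zero} _ _ = z≤n
rank-applyUpTo-mono x f g {suc m} {suc m′} (s≤s m′≤m) f≤g with g 0 <ᵇ x in g0<?x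
... | true rewrite <ᵇ-true {f 0} {x} (≤-<-trans (f≤g 0 z<s) (<ᵇ⇒< _ _ (subst T (sym g0<?x) tt))) =
  s≤s (rank-applyUpTo-mono x (f ∘ suc) (g ∘ suc) m′≤m (λ j → f≤g (suc j) ∘ s≤s))
... | false with f 0 <ᵇ x
...   | true  = m≤n⇒m≤1+n (rank-applyUpTo-mono x (f ∘ suc) (g ∘ suc) m′≤m (λ j → f≤g (suc j) ∘ s≤s))
...   | false = rank-applyUpTo-mono x (f ∘ suc) (g ∘ suc) m′≤m (λ j → f≤g (suc j) ∘ s≤s)

-- Crossing a staircase along a diagonal

⟦⟧≤1 : ∀ b → ⟦ b ⟧ ≤ 1
⟦⟧≤1 true  = ≤-refl
⟦⟧≤1 false = z≤n

indicator≡false : ∀ m b → m + ⟦ b ⟧ ≤ m → b ≡ false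
indicator≡false m false _ = refl
indicator≡false m true  m+1≤m = ⊥-elim (m+1+n≰m m m+1≤m)

≮∧≯⇒≡ : ∀ {m n} → ¬ m < n → ¬ n < m → m ≡ n
≮∧≯⇒≡ m≮n n≮m = ≤-antisym (≮⇒≥ n≮m) (≮⇒≥ m≮n)

antitone⇒≥ : (f : ℕ → ℕ) → (∀ c → 1 ≤ c → f (suc c) ≤ f c) → ∀ {c d} → 1 ≤ c → c ≤ d → f d ≤ f c
antitone⇒≥ f f↓ {c} {d} 1≤c c≤d with m≤n⇒m<n∨m≡n c≤d
... | inj₂ refl = ≤-refl
... | inj₁ (s≤s {n = d′} c≤d′) = ≤-trans (f↓ d′ (≤-trans 1≤c c≤d′)) (antitone⇒≥ f f↓ 1≤c c≤d′)

-- The cell v = (iv, cv), with rows counted from 0, holds an entry x of T^(a).  For a column c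
-- of T^(b), a c and a′ c count its entries < x and ≤ x, and occurs c says that x is one of them.
-- Row i is a coinversion row if the triple with w = (i, column i) is a coinversion triple;
-- column c is a vacancy if x is missing from it and the cell right of where x would be
-- inserted lies on the diagonal of v.
module DiagonalCrossing
  (n N : ℕ) (a a′ : ℕ → ℕ) (occurs : ℕ → Bool)
  (a-antitone  : ∀ c → 1 ≤ c → a (suc c) ≤ a c)
  (a′-antitone : ∀ c → 1 ≤ c → a′ (suc c) ≤ a′ c)
  (a′≡a+occurs : ∀ c → 1 ≤ c → c ≤ N → a′ c ≡ a c + ⟦ occurs c ⟧)
  (a-vanishes  : ∀ c → N < c → a c ≡ 0)
  (a′-vanishes : ∀ c → N < c → a′ c ≡ 0)
  (a<n : ∀ c → 1 ≤ c → a c < n)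
  (iv cv : ℕ) (iv<n : iv < n) (1≤cv : 1 ≤ cv) (cv≤N : cv ≤ N)
  where

  column : ℕ → ℕ
  column i = cv + i ∸ iv

  isCoinversionRow : ℕ → Bool
  isCoinversionRow i = (iv <ᵇ cv + i) ∧ ((a (column i) ≤ᵇ i) ∧ ((column i ≡ᵇ 1) ∨ (i <ᵇ a′ (column i ∸ 1))))

  isVacancy : ℕ → Bool
  isVacancy c = not (occurs c) ∧ (suc c + iv ≡ᵇ cv + a c)

  CoinversionRow : ℕ → ℕ → Set
  CoinversionRow i c = (c + iv ≡ cv + i) × (1 ≤ c) × (a c ≤ i) × (c ≡ 1 ⊎ i < a′ (c ∸ 1))

  Vacancy : ℕ → Set
  Vacancy c = (occurs c ≡ false) × (suc c + iv ≡ cv + a c)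

  column-≡ : ∀ {i c} → c + iv ≡ cv + i → column i ≡ c
  column-≡ {i} {c} eq = trans (cong (_∸ iv) (sym eq)) (m+n∸n≡m c iv)

  isCoinversionRow⇒ : ∀ i → T (isCoinversionRow i) → CoinversionRow i (column i)
  isCoinversionRow⇒ i t with Equivalence.to T-∧ t
  ... | iv<? , rest with Equivalence.to T-∧ rest
  ... | a≤? , left? = eq , +-cancelʳ-≤ iv 1 (column i) (subst (iv <_) (sym eq) iv<) , ≤ᵇ⇒≤ _ _ a≤? , left
    where
    iv< = <ᵇ⇒< iv (cv + i) iv<?
    eq  = m∸n+n≡m (<⇒≤ iv<)
    left : column i ≡ 1 ⊎ i < a′ (column i ∸ 1)
    left with Equivalence.to T-∨ left?
    ... | inj₁ t = inj₁ (≡ᵇ⇒≡ _ _ t)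
    ... | inj₂ t = inj₂ (<ᵇ⇒< _ _ t)

  ⇒isCoinversionRow : ∀ i c → CoinversionRow i c → T (isCoinversionRow i)
  ⇒isCoinversionRow i c (eq , 1≤c , a≤i , left) rewrite column-≡ eq =
    Equivalence.from T-∧ (<⇒<ᵇ (subst (iv <_) eq (+-monoˡ-≤ iv 1≤c)) ,
      Equivalence.from T-∧ (≤⇒≤ᵇ a≤i , Equivalence.from T-∨ (Data.Sum.map (≡⇒≡ᵇ c 1) <⇒<ᵇ left)))

  isVacancy⇒ : ∀ c → T (isVacancy c) → Vacancy c
  isVacancy⇒ c t with occurs c
  ... | false = refl , ≡ᵇ⇒≡ _ _ t

  ⇒isVacancy : ∀ c → Vacancy c → T (isVacancy c)
  ⇒isVacancy c (absent , eq) rewrite absent = ≡⇒≡ᵇ _ _ eq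

  a≤a′ : ∀ c → 1 ≤ c → a c ≤ a′ c
  a≤a′ c 1≤c with c ≤? N
  ... | yes c≤N = subst (a c ≤_) (sym (a′≡a+occurs c 1≤c c≤N)) (m≤m+n (a c) _)
  ... | no  c≰N = subst (_≤ a′ c) (sym (a-vanishes c (≰⇒> c≰N))) z≤n

  a′≤1+a : ∀ c → 1 ≤ c → a′ c ≤ suc (a c)
  a′≤1+a c 1≤c with c ≤? N
  ... | yes c≤N = subst (_≤ suc (a c)) (sym (a′≡a+occurs c 1≤c c≤N))
                        (subst (a c + ⟦ occurs c ⟧ ≤_) (+-comm (a c) 1) (+-monoʳ-≤ (a c) (⟦⟧≤1 (occurs c))))
  ... | no  c≰N = subst (_≤ suc (a c)) (sym (a′-vanishes c (≰⇒> c≰N))) z≤n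

  coinversionRows-unique : ∀ {i j ci cj} → CoinversionRow i ci → CoinversionRow j cj → ¬ i < j
  coinversionRows-unique {i} {j} {ci} {cj} (eqi , 1≤ci , a≤i , _) (eqj , _ , _ , leftj) i<j = go cj ci<cj leftj
    where
    ci<cj : ci < cj
    ci<cj = +-cancelʳ-< iv ci cj (subst₂ _<_ (sym eqi) (sym eqj) (+-monoʳ-< cv i<j))
    go : ∀ c → ci < c → (c ≡ 1 ⊎ j < a′ (c ∸ 1)) → ⊥
    go (suc c) (s≤s ci≤c) (inj₁ refl) = <⇒≱ 1≤ci ci≤c
    go (suc c) (s≤s ci≤c) (inj₂ j<a′) =
      <⇒≱ j<a′ (≤-trans (antitone⇒≥ a′ a′-antitone 1≤ci ci≤c) (≤-trans (a′≤1+a ci 1≤ci) (≤-trans (s≤s a≤i) i<j)))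

  vacancies-unique : ∀ {c d} → 1 ≤ c → Vacancy c → Vacancy d → ¬ c < d
  vacancies-unique {c} {d} 1≤c (_ , eqc) (_ , eqd) c<d =
    <⇒≱ (+-monoˡ-< iv (s≤s c<d)) (subst₂ _≤_ (sym eqd) (sym eqc) (+-monoʳ-≤ cv (antitone⇒≥ a a-antitone 1≤c (<⇒≤ c<d))))

  coinversionRow-excludes-vacancy : ∀ {i c d} → CoinversionRow i c → Within 1 N d → ¬ Vacancy d
  coinversionRow-excludes-vacancy {i} {c} {d} (eq , 1≤c , a≤i , left) (1≤d , d<1+N) (absent , eqd) with c ≤? d
  ... | yes c≤d = <⇒≱ (+-cancelˡ-< cv i (a d) (subst₂ _<_ eq eqd (+-monoˡ-< iv (s≤s c≤d)))) a[d]≤i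
    where a[d]≤i = ≤-trans (antitone⇒≥ a a-antitone 1≤c c≤d) a≤i
  ... | no  c≰d = go c (≰⇒> c≰d) eq left
    where
    a′[d]≡a[d] : a′ d ≡ a d
    a′[d]≡a[d] = trans (a′≡a+occurs d 1≤d (≤-pred d<1+N)) (trans (cong (λ b → a d + ⟦ b ⟧) absent) (+-identityʳ (a d)))
    go : ∀ c → d < c → c + iv ≡ cv + i → (c ≡ 1 ⊎ i < a′ (c ∸ 1)) → ⊥
    go (suc c) (s≤s d≤c) _  (inj₁ refl) = <⇒≱ 1≤d d≤c
    go (suc c) (s≤s d≤c) eq (inj₂ i<a′) =
      <⇒≱ (≤-trans i<a′ (subst (a′ c ≤_) a′[d]≡a[d] (antitone⇒≥ a′ a′-antitone 1≤d d≤c)))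
          (+-cancelˡ-≤ cv (a d) i (subst₂ _≤_ eqd eq (+-monoˡ-≤ iv (s≤s d≤c))))

  Crossing : Set
  Crossing = (Σ ℕ λ i → i < n × CoinversionRow i (column i)) ⊎ (Σ ℕ λ c → Within 1 N c × Vacancy c)

  coinversionRow : ∀ {i c} → i < n → CoinversionRow i c → Crossing
  coinversionRow {i} i<n row = inj₁ (i , i<n , subst (CoinversionRow i) (sym (column-≡ (proj₁ row))) row)

  vacancy : ∀ c k → 1 ≤ c → a′ c ≤ k → k ≤ a c → suc c + iv ≡ cv + k → Crossing
  vacancy c k 1≤c a′≤k k≤a eq = inj₂ (c , (1≤c , s≤s c≤N) , absent , subst (λ z → suc c + iv ≡ cv + z) k≡a eq)
    where
    k≡a : k ≡ a c
    k≡a = ≤-antisym k≤a (≤-trans (a≤a′ c 1≤c) a′≤k)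
    c≤N : c ≤ N
    c≤N with c ≤? N
    ... | yes c≤N = c≤N
    ... | no  c≰N = ⊥-elim (<⇒≱ (≰⇒> c≰N) (≤-trans (<⇒≤ c<cv) cv≤N))
      where
      k≡0 = trans k≡a (a-vanishes c (≰⇒> c≰N))
      c<cv : c < cv
      c<cv = subst (suc c ≤_) (trans eq (trans (cong (cv +_) k≡0) (+-identityʳ cv))) (m≤m+n (suc c) iv)
    absent : occurs c ≡ false
    absent = indicator≡false (a c) (occurs c) (subst (_≤ a c) (a′≡a+occurs c 1≤c c≤N) (subst (a′ c ≤_) k≡a a′≤k))

  -- Walk down the diagonal while it stays weakly above the staircase a.
  descend : ∀ m c → m < n → c + iv ≡ cv + m → 1 ≤ c → a c ≤ m → Crossing
  descend m 1 m<n eq _ a≤m = coinversionRow m<n (eq , ≤-refl , a≤m , inj₁ refl)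
  descend m (suc (suc c)) m<n eq _ a≤m with m <? a′ (suc c)
  ... | yes m<a′ = coinversionRow m<n (eq , s≤s z≤n , a≤m , inj₂ m<a′)
  descend zero (suc (suc c)) m<n eq _ a≤m | no 0≮a′ =
    vacancy (suc c) 0 (s≤s z≤n) (≮⇒≥ 0≮a′) z≤n eq
  descend (suc m) (suc (suc c)) m<n eq _ a≤m | no m≮a′ with a (suc c) ≤? m
  ... | yes a≤m′ = descend m (suc c) (<-trans (n<1+n m) m<n) (suc-injective (trans eq (+-suc cv m))) (s≤s z≤n) a≤m′
  ... | no  a≰m′ = vacancy (suc c) (suc m) (s≤s z≤n) (≮⇒≥ m≮a′) (≰⇒> a≰m′) eq

  crossing : Crossing
  crossing = descend top (column top) (n∸1<n) (m∸n+n≡m (<⇒≤ iv<cv+top)) 1≤column (≤-pred (subst (a (column top) <_) (sym 1+top≡n) (a<n _ 1≤column)))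
    where
    top = n ∸ 1
    1+top≡n : suc top ≡ n
    1+top≡n = suc-pred n ⦃ >-nonZero (≤-trans (s≤s z≤n) iv<n) ⦄
    n∸1<n : top < n
    n∸1<n = ≤-reflexive 1+top≡n
    iv<cv+top : iv < cv + top
    iv<cv+top = ≤-trans (subst (iv <_) (sym 1+top≡n) iv<n) (+-monoˡ-≤ top 1≤cv)
    1≤column : 1 ≤ column top
    1≤column = +-cancelʳ-≤ iv 1 (column top) (subst (iv <_) (sym (m∸n+n≡m (<⇒≤ iv<cv+top))) iv<cv+top)

  crossings≡1 : sumOver (⟦_⟧ ∘ isCoinversionRow) (interval 0 n) + sumOver (⟦_⟧ ∘ isVacancy) (interval 1 N) ≡ 1
  crossings≡1 with crossing
  ... | inj₁ (i , i<n , row) = cong₂ _+_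
    (sumOver-indicator-unique isCoinversionRow 0 n i (z≤n , i<n) (⇒isCoinversionRow i _ row)
      (λ j _ t → ≮∧≯⇒≡ (coinversionRows-unique (isCoinversionRow⇒ j t) row) (coinversionRows-unique row (isCoinversionRow⇒ j t))))
    (sumOver-indicator-none isVacancy 1 N (λ d d∈ t → coinversionRow-excludes-vacancy row d∈ (isVacancy⇒ d t)))
  ... | inj₂ (c , c∈ , vac) = cong₂ _+_
    (sumOver-indicator-none isCoinversionRow 0 n (λ i _ t → coinversionRow-excludes-vacancy (isCoinversionRow⇒ i t) c∈ vac))
    (sumOver-indicator-unique isVacancy 1 N c c∈ (⇒isVacancy c vac)
      (λ d (1≤d , _) t → ≮∧≯⇒≡ (vacancies-unique 1≤d (isVacancy⇒ d t) vac) (vacancies-unique (proj₁ c∈) vac (isVacancy⇒ d t))))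


-- Tableaux as sets of columns

module ColumnEncodings (n N : ℕ) where

  columnEntries : (ℕ → ℕ → Bool) → ℕ → List ℕ
  columnEntries P c = filterᵇ (P c) (range1 n)

  columnEntries-increasing : ∀ P c → Increasing (columnEntries P c)
  columnEntries-increasing P c rewrite range1≡interval n = AllPairs.filter⁺ (T? ∘ P c) (interval-increasing 1 n)

  rank-columnEntries<n : ∀ P c y → 1 ≤ y → y ≤ n → rank y (columnEntries P c) < n
  rank-columnEntries<n P c y 1≤y y≤n = begin-strict
    rank y (columnEntries P c) ≤⟨ count-filter-≤ (_<ᵇ y) (P c) (range1 n) ⟩
    rank y (range1 n)          ≡⟨ cong (rank y) (range1≡interval n) ⟩
    rank y (interval 1 n)      ≤⟨ rank-interval-≤ y 1 n ⟩
    y ∸ 1                      <⟨ ∸-monoʳ-< {o = 0} z<s 1≤y ⟩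
    y                          ≤⟨ y≤n ⟩
    n                          ∎
    where open ≤-Reasoning

  length-columnEntries≤n : ∀ P c → length (columnEntries P c) ≤ n
  length-columnEntries≤n P c = ≤-trans (length-filter (T? ∘ P c) (range1 n))
                                        (≤-reflexive (trans (length-map suc (upTo n)) (length-upTo n)))

  columnEntries-bounds : ∀ P c → All (Within 1 n) (columnEntries P c)
  columnEntries-bounds P c rewrite range1≡interval n = All.filter⁺ (T? ∘ P c) (interval-bounds 1 n)

  sumWithIndex-columnEntries : ∀ (g : ℕ → ℕ → ℕ) P c →
    sumWithIndex g (columnEntries P c) 0 ≡ sumOver (λ y → if P c y then g y (rank y (columnEntries P c)) else 0) (interval 1 n)
  sumWithIndex-columnEntries g P c rewrite range1≡interval n = sumWithIndex-filter-interval g (P c) 1 n 0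

  complementColumns : (ℕ → ℕ → Bool) → ℕ → ℕ → Bool
  complementColumns P c y = not (P (suc N ∸ c) y)

  length-split : ∀ P c → length (columnEntries (complementColumns P) c) + length (columnEntries P (suc N ∸ c)) ≡ n
  length-split P c = trans (length-filter-split (P (suc N ∸ c)) (range1 n))
                           (trans (length-map suc (upTo n)) (length-upTo n))

  rank-split : ∀ P c x → rank x (columnEntries (complementColumns P) c) + rank x (columnEntries P (suc N ∸ c)) ≡ rank x (range1 n)
  rank-split P c x = count-filter-split (_<ᵇ x) (P (suc N ∸ c)) (range1 n)

  -- A tableau R of shape ν with entries in [n] is recovered from its column sets: P c y says
  -- that y occurs in column c, and column c read upwards is the increasing list columnEntries P c.
  record ColumnEncoding (ν : Fin n → ℕ) (R : Tab n) (P : ℕ → ℕ → Bool) : Set where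
    field
      shape≤N         : ∀ i → ν i ≤ N
      inShape⇒<height : ∀ c → 1 ≤ c → c ≤ N → ∀ i → c ≤ ν i → toℕ i < length (columnEntries P c)
      <height⇒inShape : ∀ c → 1 ≤ c → c ≤ N → ∀ i → toℕ i < length (columnEntries P c) → c ≤ ν i
      entry≡nth       : ∀ c → 1 ≤ c → ∀ i → c ≤ ν i → R i c ≡ nth (columnEntries P c) (toℕ i)
      rank-antitone   : ∀ c x → 1 ≤ c → suc c ≤ N → rank x (columnEntries P (suc c)) ≤ rank x (columnEntries P c)

  vacancies : (ℕ → ℕ → Bool) → ℕ → ℕ → ℕ → ℕ
  vacancies P x iv cv = sumOver (λ c → ⟦ not (P c x) ∧ (suc c + iv ≡ᵇ cv + rank x (columnEntries P c)) ⟧) (interval 1 N)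

  module Encoded {ν : Fin n → ℕ} {R : Tab n} {P : ℕ → ℕ → Bool} (enc : ColumnEncoding ν R P) where
    open ColumnEncoding enc

    columnRank : ℕ → ℕ → ℕ
    columnRank c y = if c ≤ᵇ N then rank y (columnEntries P c) else 0

    columnRank-inside : ∀ {c} y → c ≤ N → columnRank c y ≡ rank y (columnEntries P c)
    columnRank-inside y c≤N rewrite ≤ᵇ-true c≤N = refl

    columnRank-outside : ∀ {c} y → N < c → columnRank c y ≡ 0
    columnRank-outside y N<c rewrite ≤ᵇ-false N<c = refl

    columnRank≤row-outside : ∀ {c} y i → 1 ≤ c → ¬ c ≤ ν i → columnRank c y ≤ toℕ i
    columnRank≤row-outside {c} y i 1≤c c≰ν with c ≤? N
    ... | yes c≤N = subst (_≤ toℕ i) (sym (columnRank-inside y c≤N))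
      (≤-trans (length-filter (T? ∘ (_<ᵇ y)) (columnEntries P c))
               (≮⇒≥ (c≰ν ∘ <height⇒inShape c 1≤c c≤N i)))
    ... | no  c≰N = subst (_≤ toℕ i) (sym (columnRank-outside y (≰⇒> c≰N))) z≤n

    ≤entry⇔columnRank≤ : ∀ {c} y i → 1 ≤ c → c ≤ ν i → (y ≤ R i c) ⇔ (columnRank c y ≤ toℕ i)
    ≤entry⇔columnRank≤ {c} y i 1≤c c≤ν = mk⇔
      (λ y≤R → subst (_≤ toℕ i) (sym (columnRank-inside y c≤N))
                 (≤nth⇒rank≤ (columnEntries-increasing P c) (toℕ i) i<height y (subst (y ≤_) (entry≡nth c 1≤c i c≤ν) y≤R)))
      (λ r≤i → subst (y ≤_) (sym (entry≡nth c 1≤c i c≤ν))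
                 (rank≤⇒≤nth (columnEntries-increasing P c) (toℕ i) i<height y (subst (_≤ toℕ i) (columnRank-inside y c≤N) r≤i)))
      where
      c≤N = ≤-trans c≤ν (shape≤N i)
      i<height = inShape⇒<height c 1≤c c≤N i c≤ν

    upperCondition : ∀ c x i → 1 ≤ c →
      (if inShape ν i c then x ≤ᵇ R i c else true) ≡ (columnRank c x ≤ᵇ toℕ i)
    upperCondition c x i 1≤c with c ≤? ν i
    ... | yes c≤ν rewrite ≤ᵇ-true 1≤c | ≤ᵇ-true c≤ν = T-ext
      (≤⇒≤ᵇ ∘ Equivalence.to (≤entry⇔columnRank≤ x i 1≤c c≤ν) ∘ ≤ᵇ⇒≤ _ _)
      (≤⇒≤ᵇ ∘ Equivalence.from (≤entry⇔columnRank≤ x i 1≤c c≤ν) ∘ ≤ᵇ⇒≤ _ _)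
    ... | no  c≰ν rewrite ≤ᵇ-true 1≤c | ≤ᵇ-false (≰⇒> c≰ν) = sym (≤ᵇ-true (columnRank≤row-outside x i 1≤c c≰ν))

    lowerCondition : ∀ c x i → 1 ≤ c →
      ((c ≤ᵇ suc (ν i)) ∧ ((if inShape ν i (c ∸ 1) then R i (c ∸ 1) else 0) ≤ᵇ x))
        ≡ ((c ≡ᵇ 1) ∨ (toℕ i <ᵇ columnRank (c ∸ 1) (suc x)))
    lowerCondition 1             x i _ = refl
    lowerCondition (suc (suc c)) x i _ with suc c ≤? ν i
    ... | yes c≤ν rewrite ≤ᵇ-true c≤ν = T-ext
      (λ R≤x → <⇒<ᵇ (≰⇒> (λ r≤i → <⇒≱ (s≤s (≤ᵇ⇒≤ _ _ R≤x)) (Equivalence.from (≤entry⇔columnRank≤ (suc x) i (s≤s z≤n) c≤ν) r≤i))))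
      (λ i<r → ≤⇒≤ᵇ (≮⇒≥ (λ x<R → <⇒≱ (<ᵇ⇒< _ _ i<r) (Equivalence.to (≤entry⇔columnRank≤ (suc x) i (s≤s z≤n) c≤ν) x<R))))
    ... | no  c≰ν rewrite ≤ᵇ-false (≰⇒> c≰ν) =
      sym (¬T⇒≡false (λ i<r → <⇒≱ (<ᵇ⇒< _ _ i<r) (columnRank≤row-outside (suc x) i (s≤s z≤n) c≰ν)))

    columnRank-antitone : ∀ y c → 1 ≤ c → columnRank (suc c) y ≤ columnRank c y
    columnRank-antitone y c 1≤c with suc c ≤? N
    ... | yes c<N = subst₂ _≤_ (sym (columnRank-inside y c<N)) (sym (columnRank-inside y (<⇒≤ c<N))) (rank-antitone c y 1≤c c<N)
    ... | no  c≮N = subst (_≤ columnRank c y) (sym (columnRank-outside y (≰⇒> c≮N))) z≤n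

    columnRank-suc : ∀ x → 1 ≤ x → x ≤ n → ∀ c → 1 ≤ c → c ≤ N → columnRank c (suc x) ≡ columnRank c x + ⟦ P c x ⟧
    columnRank-suc x 1≤x x≤n c 1≤c c≤N rewrite columnRank-inside (suc x) c≤N | columnRank-inside x c≤N | range1≡interval n =
      rank-filter-interval-suc (P c) 1 n x (1≤x , s≤s x≤n)

    columnRank<n : ∀ x → 1 ≤ x → x ≤ n → ∀ c → 1 ≤ c → columnRank c x < n
    columnRank<n x 1≤x x≤n c 1≤c with c ≤? N
    ... | yes c≤N = subst (_< n) (sym (columnRank-inside x c≤N)) (rank-columnEntries<n P c x 1≤x x≤n)
    ... | no  c≰N = subst (_< n) (sym (columnRank-outside x (≰⇒> c≰N))) (≤-trans 1≤x x≤n)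

    triples+vacancies≡1 : ∀ (μ : Fin n → ℕ) (S : Tab n) iv cv → 1 ≤ cv → cv ≤ N → 1 ≤ S iv cv → S iv cv ≤ n →
      sumOver (λ i → ⟦ isCoinvTriple μ S ν R iv cv i ⟧) (allFin n) + vacancies P (S iv cv) (toℕ iv) cv ≡ 1
    triples+vacancies≡1 μ S iv cv 1≤cv cv≤N 1≤x x≤n = trans (cong₂ _+_ triples≡rows vacancies≡) crossings≡1
      where
      x = S iv cv
      open DiagonalCrossing n N (λ c → columnRank c x) (λ c → columnRank c (suc x)) (λ c → P c x)
        (columnRank-antitone x) (columnRank-antitone (suc x)) (columnRank-suc x 1≤x x≤n)
        (λ _ → columnRank-outside x) (λ _ → columnRank-outside (suc x)) (columnRank<n x 1≤x x≤n)
        (toℕ iv) cv (toℕ<n iv) 1≤cv cv≤N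

      triple≡row : ∀ i → isCoinvTriple μ S ν R iv cv i ≡ isCoinversionRow (toℕ i)
      triple≡row i with toℕ iv <ᵇ cv + toℕ i in iv<?
      ... | false = refl
      ... | true  = begin
        (c ≤ᵇ suc (ν i)) ∧ ((R[u] ≤ᵇ x) ∧ upper)   ≡⟨ ∧-assoc (c ≤ᵇ suc (ν i)) _ upper ⟨
        ((c ≤ᵇ suc (ν i)) ∧ (R[u] ≤ᵇ x)) ∧ upper   ≡⟨ cong₂ _∧_ (lowerCondition c x i 1≤c) (upperCondition c x i 1≤c) ⟩
        ((c ≡ᵇ 1) ∨ (toℕ i <ᵇ columnRank (c ∸ 1) (suc x))) ∧ (columnRank c x ≤ᵇ toℕ i)
                                                  ≡⟨ ∧-comm _ (columnRank c x ≤ᵇ toℕ i) ⟩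
        (columnRank c x ≤ᵇ toℕ i) ∧ ((c ≡ᵇ 1) ∨ (toℕ i <ᵇ columnRank (c ∸ 1) (suc x))) ∎
        where
        open ≡-Reasoning
        c = cv + toℕ i ∸ toℕ iv
        R[u] = if inShape ν i (c ∸ 1) then R i (c ∸ 1) else 0
        upper = if inShape ν i c then x ≤ᵇ R i c else true
        iv<cv+i = <ᵇ⇒< (toℕ iv) (cv + toℕ i) (subst T (sym iv<?) tt)
        1≤c : 1 ≤ c
        1≤c = +-cancelʳ-≤ (toℕ iv) 1 c (subst (toℕ iv <_) (sym (m∸n+n≡m (<⇒≤ iv<cv+i))) iv<cv+i)

      triples≡rows : sumOver (λ i → ⟦ isCoinvTriple μ S ν R iv cv i ⟧) (allFin n) ≡ sumOver (⟦_⟧ ∘ isCoinversionRow) (interval 0 n)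
      triples≡rows = trans (sumOver-allFin (λ i → ⟦ isCoinvTriple μ S ν R iv cv i ⟧))
                           (trans (∑-cong _ _ (cong ⟦_⟧ ∘ triple≡row)) (∑-toℕ n (⟦_⟧ ∘ isCoinversionRow)))

      vacancies≡ : vacancies P x (toℕ iv) cv ≡ sumOver (⟦_⟧ ∘ isVacancy) (interval 1 N)
      vacancies≡ = sumOver-interval-cong 1 N λ c (_ , c<1+N) →
        cong (λ r → ⟦ not (P c x) ∧ (suc c + toℕ iv ≡ᵇ cv + r) ⟧) (sym (columnRank-inside x (≤-pred c<1+N)))

    entry-bounds : ∀ {c} i → 1 ≤ c → c ≤ ν i → 1 ≤ R i c × R i c ≤ n
    entry-bounds {c} i 1≤c c≤ν rewrite entry≡nth c 1≤c i c≤ν with nth-All (columnEntries-bounds P c) (toℕ i)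
                                                                     (inShape⇒<height c 1≤c (≤-trans c≤ν (shape≤N i)) i c≤ν)
    ... | 1≤y , y<1+n = 1≤y , ≤-pred y<1+n

    sumOver-column : ∀ (h : ℕ → ℕ → ℕ → ℕ) c → 1 ≤ c → c ≤ N →
      sumOver (λ i → if c ≤ᵇ ν i then h (R i c) (toℕ i) c else 0) (allFin n)
        ≡ sumOver (λ y → if P c y then h y (rank y (columnEntries P c)) c else 0) (interval 1 n)
    sumOver-column h c 1≤c c≤N = begin
      sumOver (λ i → if c ≤ᵇ ν i then h (R i c) (toℕ i) c else 0) (allFin n)
        ≡⟨ sumOver-allFin (λ i → if c ≤ᵇ ν i then h (R i c) (toℕ i) c else 0) ⟩
      ∑ (λ i → if c ≤ᵇ ν i then h (R i c) (toℕ i) c else 0)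
        ≡⟨ ∑-cong _ (atPosition ∘ toℕ {n}) byPosition ⟩
      ∑ (atPosition ∘ toℕ {n})
        ≡⟨ ∑-toℕ n atPosition ⟩
      sumOver atPosition (interval 0 n)
        ≡⟨ sumOver-positions (λ y j → h y j c) L 0 n (length-columnEntries≤n P c) ⟩
      sumWithIndex (λ y j → h y j c) L 0
        ≡⟨ sumWithIndex-columnEntries (λ y j → h y j c) P c ⟩
      sumOver (λ y → if P c y then h y (rank y L) c else 0) (interval 1 n) ∎
      where
      open ≡-Reasoning
      L = columnEntries P c
      atPosition = λ j → if j <ᵇ length L then h (nth L j) j c else 0
      byPosition : ∀ i → (if c ≤ᵇ ν i then h (R i c) (toℕ i) c else 0) ≡ atPosition (toℕ i)
      byPosition i with c ≤? ν i
      ... | yes c≤ν rewrite ≤ᵇ-true c≤ν | <ᵇ-true (inShape⇒<height c 1≤c c≤N i c≤ν) = cong (λ z → h z (toℕ i) c) (entry≡nth c 1≤c i c≤ν)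
      ... | no  c≰ν rewrite ≤ᵇ-false (≰⇒> c≰ν) | <ᵇ-false (≮⇒≥ (c≰ν ∘ <height⇒inShape c 1≤c c≤N i)) = refl

    sumOver-cells≡sumOver-columns : ∀ (h : ℕ → ℕ → ℕ → ℕ) →
      sumOver (λ v → h (R (proj₁ v) (proj₂ v)) (toℕ (proj₁ v)) (proj₂ v)) (cells ν)
        ≡ sumOver (λ c → sumOver (λ y → if P c y then h y (rank y (columnEntries P c)) c else 0) (interval 1 n)) (interval 1 N)
    sumOver-cells≡sumOver-columns h = begin
      sumOver F (cells ν)
        ≡⟨ sumOver-cells ν F ⟩
      sumOver (λ i → sumOver (λ c → F (i , c)) (interval 1 (ν i))) (allFin n)
        ≡⟨ sumOver-cong (λ i → sumOver-interval-extend (λ c → F (i , c)) (ν i) N (shape≤N i)) (allFin n) ⟩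
      sumOver (λ i → sumOver (λ c → if c ≤ᵇ ν i then F (i , c) else 0) (interval 1 N)) (allFin n)
        ≡⟨ sumOver-comm (λ i c → if c ≤ᵇ ν i then F (i , c) else 0) (allFin n) (interval 1 N) ⟩
      sumOver (λ c → sumOver (λ i → if c ≤ᵇ ν i then F (i , c) else 0) (allFin n)) (interval 1 N)
        ≡⟨ sumOver-interval-cong 1 N (λ c (1≤c , c<1+N) → sumOver-column h c 1≤c (≤-pred c<1+N)) ⟩
      sumOver (λ c → sumOver (λ y → if P c y then h y (rank y (columnEntries P c)) c else 0) (interval 1 n)) (interval 1 N) ∎
      where
      open ≡-Reasoning
      F = λ (v : Fin n × ℕ) → h (R (proj₁ v) (proj₂ v)) (toℕ (proj₁ v)) (proj₂ v)

initialSegment : ∀ n (q : Fin n → Set) → (∀ i → Dec (q i)) → (∀ i j → toℕ i ≤ toℕ j → q j → q i) →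
  Σ ℕ λ h → h ≤ n × (∀ i → q i → toℕ i < h) × (∀ i → toℕ i < h → q i)
initialSegment zero    q q? q↓ = 0 , z≤n , (λ ()) , (λ ())
initialSegment (suc n) q q? q↓ with q? Fin.zero
... | no ¬q0 = 0 , z≤n , (λ i qi → ⊥-elim (¬q0 (q↓ Fin.zero i z≤n qi))) , (λ _ ())
... | yes q0 with initialSegment n (q ∘ Fin.suc) (q? ∘ Fin.suc) (λ i j i≤j → q↓ (Fin.suc i) (Fin.suc j) (s≤s i≤j))
...   | h , h≤n , q⇒< , <⇒q = suc h , s≤s h≤n , q⇒<′ , <⇒q′
  where
  q⇒<′ : ∀ i → q i → toℕ i < suc h
  q⇒<′ Fin.zero    _  = z<s
  q⇒<′ (Fin.suc i) qi = s≤s (q⇒< i qi)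
  <⇒q′ : ∀ i → toℕ i < suc h → q i
  <⇒q′ Fin.zero    _        = q0
  <⇒q′ (Fin.suc i) (s≤s i<h) = <⇒q i i<h

module SemistandardColumns {n} (N : ℕ) (μ : Fin n → ℕ) (S : Tab n)
  (μ-partition : IsPartition μ) (S-ssyt : IsSSYT μ S) (μ≤N : ∀ i → μ i ≤ N) where
  open ColumnEncodings n N

  entry : ℕ → ℕ → ℕ
  entry c j with j <? n
  ... | yes j<n = S (fromℕ< j<n) c
  ... | no  _   = 0

  entry-fromℕ< : ∀ c j (j<n : j < n) → entry c j ≡ S (fromℕ< j<n) c
  entry-fromℕ< c j j<n with j <? n
  ... | yes j<n′ = cong (λ r → S r c) (fromℕ<-cong j j refl j<n′ j<n)
  ... | no  j≮n  = ⊥-elim (j≮n j<n)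

  entry-toℕ : ∀ c i → entry c (toℕ i) ≡ S i c
  entry-toℕ c i = trans (entry-fromℕ< c (toℕ i) (toℕ<n i)) (cong (λ r → S r c) (fromℕ<-toℕ i (toℕ<n i)))

  module Column (c : ℕ) (1≤c : 1 ≤ c) where

    private
      segment = initialSegment n (λ i → c ≤ μ i) (λ i → c ≤? μ i) (λ i j i≤j c≤μj → ≤-trans c≤μj (μ-partition i j i≤j))

    height : ℕ
    height = proj₁ segment

    height≤n : height ≤ n
    height≤n = proj₁ (proj₂ segment)

    inShape⇒<height : ∀ i → c ≤ μ i → toℕ i < height
    inShape⇒<height = proj₁ (proj₂ (proj₂ segment))

    <height⇒inShape : ∀ i → toℕ i < height → c ≤ μ i
    <height⇒inShape = proj₂ (proj₂ (proj₂ segment))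

    row<n : ∀ {j} → j < height → j < n
    row<n j<h = ≤-trans j<h height≤n

    rowInShape : ∀ {j} (j<h : j < height) → c ≤ μ (fromℕ< (row<n j<h))
    rowInShape {j} j<h = <height⇒inShape (fromℕ< (row<n j<h)) (subst (_< height) (sym (toℕ-fromℕ< (row<n j<h))) j<h)

    entries : List ℕ
    entries = applyUpTo (entry c) height

    entry-adjacent : ∀ {j} → suc j < height → entry c j < entry c (suc j)
    entry-adjacent {j} j+1<h =
      subst₂ _<_ (sym (entry-fromℕ< c j j<n)) (sym (entry-fromℕ< c (suc j) (row<n j+1<h)))
        (proj₂ (proj₂ S-ssyt) (fromℕ< j<n) (fromℕ< (row<n j+1<h))
           (trans (toℕ-fromℕ< (row<n j+1<h)) (cong suc (sym (toℕ-fromℕ< j<n)))) c 1≤c (rowInShape j+1<h))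
      where j<n = row<n (<-trans (n<1+n j) j+1<h)

    entry-strict : ∀ {i j} → i < j → j < height → entry c i < entry c j
    entry-strict {i} {suc j} (s≤s i≤j) j+1<h with m≤n⇒m<n∨m≡n i≤j
    ... | inj₂ refl = entry-adjacent j+1<h
    ... | inj₁ i<j  = <-trans (entry-strict i<j (<-trans (n<1+n j) j+1<h)) (entry-adjacent j+1<h)

    entries-increasing : Increasing entries
    entries-increasing = AllPairs.applyUpTo⁺₁ (entry c) height entry-strict

    entries-bounds : ∀ {y} → y ∈ entries → Within 1 n y
    entries-bounds y∈ with ∈-applyUpTo⁻ (entry c) y∈
    ... | j , j<h , refl with proj₁ S-ssyt (fromℕ< (row<n j<h)) c 1≤c (rowInShape j<h)
    ...   | 1≤S , S≤n = subst (Within 1 n) (sym (entry-fromℕ< c j (row<n j<h))) (1≤S , s≤s S≤n)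

    ∈entries⇒inColumn : ∀ {y} → y ∈ entries → T (inColumn μ S c y)
    ∈entries⇒inColumn y∈ with ∈-applyUpTo⁻ (entry c) y∈
    ... | j , j<h , refl = any⁺ _ (lose (∈-allFin (fromℕ< (row<n j<h)))
            (Equivalence.from T-∧ (≤⇒≤ᵇ (rowInShape j<h) , ≡⇒≡ᵇ _ _ (sym (entry-fromℕ< c j (row<n j<h))))))

    inColumn⇒∈entries : ∀ {y} → T (inColumn μ S c y) → y ∈ entries
    inColumn⇒∈entries {y} t with satisfied (any⁻ _ (allFin n) t)
    ... | r , inCol with Equivalence.to T-∧ inCol
    ...   | c≤μ , S≡y = subst (_∈ entries) (trans (entry-toℕ c r) (≡ᵇ⇒≡ _ _ S≡y))
                          (∈-applyUpTo⁺ (entry c) (inShape⇒<height r (≤ᵇ⇒≤ _ _ c≤μ)))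

    columnEntries≡entries : columnEntries (inColumn μ S) c ≡ entries
    columnEntries≡entries = increasing-extensional (columnEntries-increasing (inColumn μ S) c) entries-increasing
      (λ y∈ → inColumn⇒∈entries (proj₂ (∈-filter⁻ (T? ∘ inColumn μ S c) {xs = range1 n} y∈)))
      (λ y∈ → ∈-filter⁺ (T? ∘ inColumn μ S c) (subst (_ ∈_) (sym (range1≡interval n)) (∈-interval⁺ (entries-bounds y∈))) (∈entries⇒inColumn y∈))

    length-columnEntries : length (columnEntries (inColumn μ S) c) ≡ height
    length-columnEntries = trans (cong length columnEntries≡entries) (length-applyUpTo (entry c) height)

  height-antitone : ∀ c (1≤c : 1 ≤ c) → Column.height (suc c) (m≤n⇒m≤1+n 1≤c) ≤ Column.height c 1≤c
  height-antitone c 1≤c = ≮⇒≥ λ h<h′ →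
    let r = fromℕ< (≤-trans h<h′ (C′.height≤n)) in
    <-irrefl (toℕ-fromℕ< _)
      (C.inShape⇒<height r (≤-trans (n≤1+n c) (C′.<height⇒inShape r (subst (_< C′.height) (sym (toℕ-fromℕ< _)) h<h′))))
    where module C = Column c 1≤c
          module C′ = Column (suc c) (m≤n⇒m≤1+n 1≤c)

  rank-column-antitone : ∀ c x → 1 ≤ c →
    rank x (columnEntries (inColumn μ S) (suc c)) ≤ rank x (columnEntries (inColumn μ S) c)
  rank-column-antitone c x 1≤c =
    subst₂ (λ l l′ → rank x l ≤ rank x l′) (sym C′.columnEntries≡entries) (sym C.columnEntries≡entries)
      (rank-applyUpTo-mono x (entry c) (entry (suc c)) (height-antitone c 1≤c) row-weak)
    where
    module C = Column c 1≤c
    module C′ = Column (suc c) (m≤n⇒m≤1+n 1≤c)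
    row-weak : ∀ j → j < C′.height → entry c j ≤ entry (suc c) j
    row-weak j j<h′ = subst₂ _≤_ (sym (entry-fromℕ< c j j<n)) (sym (entry-fromℕ< (suc c) j j<n))
                        (proj₁ (proj₂ S-ssyt) (fromℕ< j<n) c 1≤c (C′.rowInShape j<h′))
      where j<n = C′.row<n j<h′

  columnEncoding : ColumnEncoding μ S (inColumn μ S)
  columnEncoding = record
    { shape≤N         = μ≤N
    ; inShape⇒<height = λ c 1≤c _ i c≤μ → subst (toℕ i <_) (sym (Column.length-columnEntries c 1≤c)) (Column.inShape⇒<height c 1≤c i c≤μ)
    ; <height⇒inShape = λ c 1≤c _ i i< → Column.<height⇒inShape c 1≤c i (subst (toℕ i <_) (Column.length-columnEntries c 1≤c) i<)
    ; entry≡nth       = λ c 1≤c i c≤μ → sym (trans (cong (λ l → nth l (toℕ i)) (Column.columnEntries≡entries c 1≤c))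
                          (trans (nth-applyUpTo (entry c) _ (toℕ i) (Column.inShape⇒<height c 1≤c i c≤μ)) (entry-toℕ c i)))
    ; rank-antitone   = λ c x 1≤c _ → rank-column-antitone c x 1≤c
    }

module ComplementColumns {n} (N : ℕ) (μ : Fin n → ℕ) (S : Tab n)
  (enc : ColumnEncodings.ColumnEncoding n N μ S (inColumn μ S)) where
  open ColumnEncodings n N
  open ColumnEncoding enc

  μᶜ : Fin n → ℕ
  μᶜ i = N ∸ μ (opposite i)

  Pᶜ : ℕ → ℕ → Bool
  Pᶜ = complementColumns (inColumn μ S)

  opposite+1+i≡n : ∀ (i : Fin n) → toℕ (opposite i) + suc (toℕ i) ≡ n
  opposite+1+i≡n i = trans (cong (_+ suc (toℕ i)) (opposite-prop i)) (m∸n+n≡m (toℕ<n i))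

  mirror-within : ∀ {c} → 1 ≤ c → c ≤ N → 1 ≤ suc N ∸ c × suc N ∸ c ≤ N
  mirror-within {c} 1≤c c≤N = subst (1 ≤_) (sym (+-∸-assoc 1 c≤N)) (s≤s z≤n) , ∸-monoʳ-≤ (suc N) 1≤c

  ≤μᶜ⇔ : ∀ {c} i → c ≤ N → (c ≤ μᶜ i) ⇔ (μ (opposite i) < suc N ∸ c)
  ≤μᶜ⇔ {c} i c≤N = mk⇔
    (λ c≤μᶜ → +-cancelʳ-< c a e (subst (a + c <_) (sym e+c≡) (s≤s (subst (_≤ N) (+-comm c a) (m≤o∸n⇒m+n≤o c (shape≤N (opposite i)) c≤μᶜ)))))
    (λ a<e → m+n≤o⇒m≤o∸n c (≤-pred (subst (_< suc N) (+-comm a c) (subst (a + c <_) e+c≡ (+-monoˡ-< c a<e)))))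
    where
    a = μ (opposite i)
    e = suc N ∸ c
    e+c≡ : e + c ≡ suc N
    e+c≡ = m∸n+n≡m (≤-trans c≤N (n≤1+n N))

  inShapeᶜ⇔ : ∀ {c} → 1 ≤ c → c ≤ N → ∀ i → (c ≤ μᶜ i) ⇔ (length (columnEntries (inColumn μ S) (suc N ∸ c)) ≤ toℕ (opposite i))
  inShapeᶜ⇔ {c} 1≤c c≤N i = mk⇔
    (λ c≤μᶜ → ≮⇒≥ λ i′<h → <⇒≱ (Equivalence.to (≤μᶜ⇔ i c≤N) c≤μᶜ) (<height⇒inShape (suc N ∸ c) 1≤e e≤N (opposite i) i′<h))
    (λ h≤i′ → Equivalence.from (≤μᶜ⇔ i c≤N) (≰⇒> λ e≤a → <⇒≱ (inShape⇒<height (suc N ∸ c) 1≤e e≤N (opposite i) e≤a) h≤i′))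
    where 1≤e = proj₁ (mirror-within 1≤c c≤N)
          e≤N = proj₂ (mirror-within 1≤c c≤N)

  heightᶜ⇔ : ∀ c i → (toℕ i < length (columnEntries Pᶜ c)) ⇔ (length (columnEntries (inColumn μ S) (suc N ∸ c)) ≤ toℕ (opposite i))
  heightᶜ⇔ c i = mk⇔
    (λ i<Lᶜ → +-cancelʳ-≤ (suc (toℕ i)) L (toℕ (opposite i))
                (subst (L + suc (toℕ i) ≤_) (sym (opposite+1+i≡n i))
                   (subst (L + suc (toℕ i) ≤_) (trans (+-comm L Lᶜ) (length-split (inColumn μ S) c)) (+-monoʳ-≤ L i<Lᶜ))))
    (λ L≤i′ → +-cancelʳ-≤ L (suc (toℕ i)) Lᶜ
                (subst (suc (toℕ i) + L ≤_) (sym (length-split (inColumn μ S) c))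
                   (subst (suc (toℕ i) + L ≤_) (trans (+-comm (suc (toℕ i)) _) (opposite+1+i≡n i)) (+-monoʳ-≤ (suc (toℕ i)) L≤i′))))
    where
    L = length (columnEntries (inColumn μ S) (suc N ∸ c))
    Lᶜ = length (columnEntries Pᶜ c)

  rankᶜ-antitone : ∀ c x → 1 ≤ c → suc c ≤ N → rank x (columnEntries Pᶜ (suc c)) ≤ rank x (columnEntries Pᶜ c)
  rankᶜ-antitone c x 1≤c c<N = +-cancelʳ-≤ (r (N ∸ c)) (rᶜ (suc c)) (rᶜ c) (begin
    rᶜ (suc c) + r (N ∸ c)       ≡⟨ rank-split (inColumn μ S) (suc c) x ⟩
    rank x (range1 n)            ≡⟨ rank-split (inColumn μ S) c x ⟨
    rᶜ c + r (suc N ∸ c)         ≡⟨ cong (λ e → rᶜ c + r e) (+-∸-assoc 1 (<⇒≤ c<N)) ⟩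
    rᶜ c + r (suc (N ∸ c))       ≤⟨ +-monoʳ-≤ (rᶜ c) (rank-antitone (N ∸ c) x 1≤N∸c N∸c<N) ⟩
    rᶜ c + r (N ∸ c)             ∎)
    where
    open ≤-Reasoning
    r = λ e → rank x (columnEntries (inColumn μ S) e)
    rᶜ = λ e → rank x (columnEntries Pᶜ e)
    1≤N∸c = m<n⇒0<n∸m c<N
    N∸c<N = subst (_≤ N) (+-∸-assoc 1 (<⇒≤ c<N)) (proj₂ (mirror-within 1≤c (<⇒≤ c<N)))

  encodingᶜ : ColumnEncoding μᶜ (Φ₁ N μ S) Pᶜ
  encodingᶜ = record
    { shape≤N         = λ i → m∸n≤m N (μ (opposite i))
    ; inShape⇒<height = λ c 1≤c c≤N i → Equivalence.from (heightᶜ⇔ c i) ∘ Equivalence.to (inShapeᶜ⇔ 1≤c c≤N i)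
    ; <height⇒inShape = λ c 1≤c c≤N i → Equivalence.from (inShapeᶜ⇔ 1≤c c≤N i) ∘ Equivalence.to (heightᶜ⇔ c i)
    ; entry≡nth       = λ _ _ _ _ → refl
    ; rank-antitone   = rankᶜ-antitone
    }

-- One pair of tableaux

pairCoinv : ∀ {n} → (Fin n → ℕ) → Tab n → (Fin n → ℕ) → Tab n → ℕ
pairCoinv {n} μ S ν R = sum (concatMap (λ v → map (λ i → ⟦ isCoinvTriple μ S ν R (proj₁ v) (proj₂ v) i ⟧) (allFin n)) (cells μ))

module PairIdentity (n N : ℕ) where
  open ColumnEncodings n N

  cellVacancies : (Fin n → ℕ) → Tab n → (ℕ → ℕ → Bool) → ℕ
  cellVacancies μ S P = sumOver (λ v → vacancies P (S (proj₁ v) (proj₂ v)) (toℕ (proj₁ v)) (proj₂ v)) (cells μ)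

  pairCoinv+cellVacancies≡size : ∀ {μ ν S R PS PR} → ColumnEncoding μ S PS → ColumnEncoding ν R PR →
    pairCoinv μ S ν R + cellVacancies μ S PR ≡ ∑ μ
  pairCoinv+cellVacancies≡size {μ} {ν} {S} {R} {PS} {PR} encS encR = begin
    pairCoinv μ S ν R + sumOver vacanciesAt (cells μ)
      ≡⟨ cong (_+ sumOver vacanciesAt (cells μ)) (sum-concatMap _ (cells μ)) ⟩
    sumOver triplesAt (cells μ) + sumOver vacanciesAt (cells μ)
      ≡⟨ sumOver-distrib-+ triplesAt vacanciesAt (cells μ) ⟨
    sumOver (λ v → triplesAt v + vacanciesAt v) (cells μ)
      ≡⟨ sumOver-cells μ _ ⟩
    sumOver (λ i → sumOver (λ c → triplesAt (i , c) + vacanciesAt (i , c)) (interval 1 (μ i))) (allFin n)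
      ≡⟨ sumOver-cong (λ i → sumOver-interval-cong 1 (μ i) (λ c (1≤c , c<1+μ) → oneCrossing i c 1≤c (≤-pred c<1+μ))) (allFin n) ⟩
    sumOver (λ i → sumOver (λ _ → 1) (interval 1 (μ i))) (allFin n)
      ≡⟨ sumOver-cells μ _ ⟨
    sumOver (λ _ → 1) (cells μ)
      ≡⟨ number-of-cells μ ⟩
    ∑ μ ∎
    where
    open ≡-Reasoning
    triplesAt = λ (v : Fin n × ℕ) → sumOver (λ i → ⟦ isCoinvTriple μ S ν R (proj₁ v) (proj₂ v) i ⟧) (allFin n)
    vacanciesAt = λ (v : Fin n × ℕ) → vacancies PR (S (proj₁ v) (proj₂ v)) (toℕ (proj₁ v)) (proj₂ v)
    oneCrossing : ∀ i c → 1 ≤ c → c ≤ μ i → triplesAt (i , c) + vacanciesAt (i , c) ≡ 1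
    oneCrossing i c 1≤c c≤μ = Encoded.triples+vacancies≡1 encR μ S i c 1≤c (≤-trans c≤μ (ColumnEncoding.shape≤N encS i))
                                (proj₁ bounds) (proj₂ bounds)
      where bounds = Encoded.entry-bounds encS i 1≤c c≤μ

  vacancyWitness : (ℕ → ℕ → Bool) → (ℕ → ℕ → Bool) → ℕ → ℕ → ℕ → ℕ
  vacancyWitness PS PR c y d =
    ⟦ PS c y ∧ (not (PR d y) ∧ (suc d + rank y (columnEntries PS c) ≡ᵇ c + rank y (columnEntries PR d))) ⟧

  cellVacancies-by-columns : ∀ {μ S PS} → ColumnEncoding μ S PS → ∀ PR →
    cellVacancies μ S PR ≡ sumOver (λ c → sumOver (λ y → sumOver (vacancyWitness PS PR c y) (interval 1 N)) (interval 1 n)) (interval 1 N)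
  cellVacancies-by-columns {μ} {S} {PS} encS PR =
    trans (Encoded.sumOver-cells≡sumOver-columns encS (vacancies PR))
          (sumOver-cong (λ c → sumOver-cong (witnesses c) (interval 1 n)) (interval 1 N))
    where
    witnesses : ∀ c y → (if PS c y then vacancies PR y (rank y (columnEntries PS c)) c else 0)
                        ≡ sumOver (vacancyWitness PS PR c y) (interval 1 N)
    witnesses c y with PS c y
    ... | true  = refl
    ... | false = sym (sumOver-zero (interval 1 N))

  balance : ∀ {A B u w c d a b M K} → A + c ≡ M → B + d ≡ M → u + b ≡ K → w + a ≡ K →
    (suc A + u ≡ᵇ B + w) ≡ (suc d + a ≡ᵇ c + b)
  balance {A} {B} {u} {w} {c} {d} {a} {b} {M} {K} A+c B+d u+b w+a = T-ext
    (λ t → ≡⇒≡ᵇ (suc d + a) (c + b) (+-cancelˡ-≡ (M + K) (suc d + a) (c + b) (begin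
      M + K + (suc d + a)               ≡⟨ cong₂ (λ x y → x + y + (suc d + a)) A+c u+b ⟨
      A + c + (u + b) + (suc d + a)     ≡⟨ lhs A u c d a b ⟩
      suc A + u + (c + d + a + b)       ≡⟨ cong (_+ (c + d + a + b)) (≡ᵇ⇒≡ (suc A + u) (B + w) t) ⟩
      B + w + (c + d + a + b)           ≡⟨ rhs B w c d a b ⟩
      B + d + (w + a) + (c + b)         ≡⟨ cong₂ (λ x y → x + y + (c + b)) B+d w+a ⟩
      M + K + (c + b)                   ∎)))
    (λ t → ≡⇒≡ᵇ (suc A + u) (B + w) (+-cancelʳ-≡ (c + d + a + b) (suc A + u) (B + w) (begin
      suc A + u + (c + d + a + b)       ≡⟨ lhs A u c d a b ⟨
      A + c + (u + b) + (suc d + a)     ≡⟨ cong₂ (λ x y → x + y + (suc d + a)) A+c u+b ⟩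
      M + K + (suc d + a)               ≡⟨ cong (M + K +_) (≡ᵇ⇒≡ (suc d + a) (c + b) t) ⟩
      M + K + (c + b)                   ≡⟨ cong₂ (λ x y → x + y + (c + b)) B+d w+a ⟨
      B + d + (w + a) + (c + b)         ≡⟨ rhs B w c d a b ⟨
      B + w + (c + d + a + b)           ∎)))
    where
    open ≡-Reasoning
    lhs : ∀ A u c d a b → A + c + (u + b) + (suc d + a) ≡ suc A + u + (c + d + a + b)
    lhs = solve-∀
    rhs : ∀ B w c d a b → B + w + (c + d + a + b) ≡ B + d + (w + a) + (c + b)
    rhs = solve-∀

  vacancyWitness-mirror : ∀ PS PR c y d → c ≤ N → d ≤ N →
    vacancyWitness (complementColumns PR) (complementColumns PS) (suc N ∸ d) y (suc N ∸ c) ≡ vacancyWitness PS PR c y d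
  vacancyWitness-mirror PS PR c y d c≤N d≤N
    rewrite m∸[m∸n]≡n (m≤n⇒m≤1+n c≤N) | m∸[m∸n]≡n (m≤n⇒m≤1+n d≤N) =
    cong ⟦_⟧ (trans (cong (not (PR d y) ∧_) (cong₂ _∧_ (not-involutive (PS c y))
                      (balance {A = suc N ∸ c} {B = suc N ∸ d} {c = c} {d = d} (m∸n+n≡m (m≤n⇒m≤1+n c≤N)) (m∸n+n≡m (m≤n⇒m≤1+n d≤N))
                               (count-filter-split (_<ᵇ y) (PR d) (range1 n)) (count-filter-split (_<ᵇ y) (PS c) (range1 n)))))
                    (∧-swap (not (PR d y)) (PS c y) _))
    where
    ∧-swap : ∀ a b c → a ∧ (b ∧ c) ≡ b ∧ (a ∧ c)
    ∧-swap a b c = trans (sym (∧-assoc a b c)) (trans (cong (_∧ c) (∧-comm a b)) (∧-assoc b a c))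

  cellVacancies-complement : ∀ {μ ν S R PS PR} → ColumnEncoding μ S PS → ColumnEncoding ν R (complementColumns PR) →
    cellVacancies μ S PR ≡ cellVacancies ν R (complementColumns PS)
  cellVacancies-complement {PS = PS} {PR} encS encR = begin
    cellVacancies _ _ PR
      ≡⟨ cellVacancies-by-columns encS PR ⟩
    sumOver (λ c → sumOver (λ y → sumOver (λ d → W c y d) [1,N]) [1,n]) [1,N]
      ≡⟨ sumOver-cong (λ c → sumOver-comm (W c) [1,n] [1,N]) [1,N] ⟩
    sumOver (λ c → sumOver (λ d → sumOver (λ y → W c y d) [1,n]) [1,N]) [1,N]
      ≡⟨ sumOver-comm (λ c d → sumOver (λ y → W c y d) [1,n]) [1,N] [1,N] ⟩
    sumOver (λ d → sumOver (λ c → sumOver (λ y → W c y d) [1,n]) [1,N]) [1,N]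
      ≡⟨ sumOver-cong (λ d → sumOver-comm (λ c y → W c y d) [1,N] [1,n]) [1,N] ⟩
    sumOver (λ d → sumOver (λ y → sumOver (λ c → W c y d) [1,N]) [1,n]) [1,N]
      ≡⟨ sumOver-interval-cong 1 N (λ d (_ , d<1+N) → sumOver-cong (λ y → sumOver-interval-cong 1 N (λ c (_ , c<1+N) →
           sym (vacancyWitness-mirror PS PR c y d (≤-pred c<1+N) (≤-pred d<1+N)))) [1,n]) ⟩
    sumOver (λ d → sumOver (λ y → sumOver (λ c → W′ (suc N ∸ d) y (suc N ∸ c)) [1,N]) [1,n]) [1,N]
      ≡⟨ sumOver-interval-reverse (λ e → sumOver (λ y → sumOver (λ c → W′ e y (suc N ∸ c)) [1,N]) [1,n]) N ⟨
    sumOver (λ e → sumOver (λ y → sumOver (λ c → W′ e y (suc N ∸ c)) [1,N]) [1,n]) [1,N]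
      ≡⟨ sumOver-cong (λ e → sumOver-cong (λ y → sumOver-interval-reverse (W′ e y) N) [1,n]) [1,N] ⟨
    sumOver (λ e → sumOver (λ y → sumOver (λ e′ → W′ e y e′) [1,N]) [1,n]) [1,N]
      ≡⟨ cellVacancies-by-columns encR (complementColumns PS) ⟨
    cellVacancies _ _ (complementColumns PS) ∎
    where
    open ≡-Reasoning
    [1,N] = interval 1 N
    [1,n] = interval 1 n
    W = vacancyWitness PS PR
    W′ = vacancyWitness (complementColumns PR) (complementColumns PS)

  size-complement : ∀ (μ : Fin n → ℕ) → (∀ i → μ i ≤ N) → ∑ (λ i → N ∸ μ (opposite i)) + ∑ μ ≡ n * N
  size-complement μ μ≤N = begin
    ∑ (λ i → N ∸ μ (opposite i)) + ∑ μ                      ≡⟨ cong (∑ (λ i → N ∸ μ (opposite i)) +_) (∑-opposite μ) ⟨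
    ∑ (λ i → N ∸ μ (opposite i)) + ∑ (μ ∘ opposite)         ≡⟨ ∑-distrib-+ (λ i → N ∸ μ (opposite i)) (μ ∘ opposite) ⟨
    ∑ (λ i → N ∸ μ (opposite i) + μ (opposite i))           ≡⟨ ∑-cong _ _ (λ i → m∸n+n≡m (μ≤N (opposite i))) ⟩
    ∑ {n} (λ _ → N)                                         ≡⟨ ∑-const n N ⟩
    n * N                                                   ∎
    where open ≡-Reasoning

  pair-identity : ∀ (μ ν : Fin n → ℕ) (S R : Tab n) → IsPartition μ → IsPartition ν → IsSSYT μ S → IsSSYT ν R →
    (∀ i → μ i ≤ N) → (∀ i → ν i ≤ N) →
    pairCoinv μ S ν R + n * N ≡ ∑ μ + ∑ ν + pairCoinv (λ i → N ∸ ν (opposite i)) (Φ₁ N ν R) (λ i → N ∸ μ (opposite i)) (Φ₁ N μ S)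
  pair-identity μ ν S R μ-partition ν-partition S-ssyt R-ssyt μ≤N ν≤N = begin
    pS + n * N                     ≡⟨ cong (pS +_) (size-complement ν ν≤N) ⟨
    pS + (∑ νᶜ + ∑ ν)              ≡⟨ cong (λ z → pS + (z + ∑ ν)) (pairCoinv+cellVacancies≡size encRᶜ encSᶜ) ⟨
    pS + ((pΦ + Zᶜ) + ∑ ν)         ≡⟨ rearrange pS pΦ Zᶜ (∑ ν) ⟩
    pS + Zᶜ + ∑ ν + pΦ             ≡⟨ cong (λ z → pS + z + ∑ ν + pΦ) (cellVacancies-complement encS encRᶜ) ⟨
    pS + Z + ∑ ν + pΦ              ≡⟨ cong (λ z → z + ∑ ν + pΦ) (pairCoinv+cellVacancies≡size encS encR) ⟩
    ∑ μ + ∑ ν + pΦ                 ∎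
    where
    open ≡-Reasoning
    encS  = SemistandardColumns.columnEncoding N μ S μ-partition S-ssyt μ≤N
    encR  = SemistandardColumns.columnEncoding N ν R ν-partition R-ssyt ν≤N
    encSᶜ = ComplementColumns.encodingᶜ N μ S encS
    encRᶜ = ComplementColumns.encodingᶜ N ν R encR
    νᶜ = λ i → N ∸ ν (opposite i)
    pS = pairCoinv μ S ν R
    pΦ = pairCoinv νᶜ (Φ₁ N ν R) (λ i → N ∸ μ (opposite i)) (Φ₁ N μ S)
    Z  = cellVacancies μ S (inColumn ν R)
    Zᶜ = cellVacancies νᶜ (Φ₁ N ν R) (complementColumns (inColumn μ S))
    rearrange : ∀ p q z t → p + ((q + z) + t) ≡ p + z + t + q
    rearrange = solve-∀

-- Summing over pairs

sumOverPairs : ∀ {k} → (Fin k → Fin k → ℕ) → ℕ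
sumOverPairs f = ∑ (λ a → ∑ (λ b → if toℕ a <ᵇ toℕ b then f a b else 0))

sumOverPairs-cong : ∀ {k} {f g : Fin k → Fin k → ℕ} → (∀ a b → f a b ≡ g a b) → sumOverPairs f ≡ sumOverPairs g
sumOverPairs-cong f≗g = ∑-cong _ _ λ a → ∑-cong _ _ λ b → cong (λ z → if _ then z else 0) (f≗g a b)

sumOverPairs-distrib-+ : ∀ {k} (f g : Fin k → Fin k → ℕ) → sumOverPairs (λ a b → f a b + g a b) ≡ sumOverPairs f + sumOverPairs g
sumOverPairs-distrib-+ f g =
  trans (∑-cong _ _ λ a → trans (∑-cong _ _ λ b → if-+ (toℕ a <ᵇ toℕ b) (f a b) (g a b)) (∑-distrib-+ (guarded f a) (guarded g a)))
        (∑-distrib-+ (λ a → ∑ (guarded f a)) (λ a → ∑ (guarded g a)))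
  where
  guarded = λ (h : Fin _ → Fin _ → ℕ) a b → if toℕ a <ᵇ toℕ b then h a b else 0
  if-+ : ∀ c x y → (if c then x + y else 0) ≡ (if c then x else 0) + (if c then y else 0)
  if-+ true  x y = refl
  if-+ false x y = refl

sumOverPairs-const : ∀ k c → sumOverPairs {k} (λ _ _ → c) ≡ (k C 2) * c
sumOverPairs-const zero    c = refl
sumOverPairs-const (suc k) c = begin
  ∑ {k} (λ _ → c) + sumOverPairs {k} (λ _ _ → c) ≡⟨ cong₂ _+_ (∑-const k c) (sumOverPairs-const k c) ⟩
  k * c + (k C 2) * c                            ≡⟨ *-distribʳ-+ c k (k C 2) ⟨
  (k + k C 2) * c                                ≡⟨ cong (λ z → (z + k C 2) * c) (nC1≡n k) ⟨
  (k C 1 + k C 2) * c                            ≡⟨ cong (_* c) (nCk+nC[k+1]≡[n+1]C[k+1] k 1) ⟩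
  (suc k C 2) * c                                ∎
  where open ≡-Reasoning

sumOverPairs-symmetric : ∀ k (s : Fin k → ℕ) → sumOverPairs (λ a b → s a + s b) ≡ (k ∸ 1) * ∑ s
sumOverPairs-symmetric zero    s = refl
sumOverPairs-symmetric (suc k) s = begin
  ∑ (λ b → s₀ + s′ b) + sumOverPairs (λ a b → s′ a + s′ b) ≡⟨ cong₂ _+_ (∑-distrib-+ (λ _ → s₀) s′) (sumOverPairs-symmetric k s′) ⟩
  (∑ {k} (λ _ → s₀) + ∑ s′) + (k ∸ 1) * ∑ s′              ≡⟨ cong (λ z → z + ∑ s′ + (k ∸ 1) * ∑ s′) (∑-const k s₀) ⟩
  (k * s₀ + ∑ s′) + (k ∸ 1) * ∑ s′                        ≡⟨ +-assoc (k * s₀) _ _ ⟩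
  k * s₀ + (∑ s′ + (k ∸ 1) * ∑ s′)                        ≡⟨ cong (k * s₀ +_) (once-more k s′) ⟩
  k * s₀ + k * ∑ s′                                       ≡⟨ *-distribˡ-+ k s₀ (∑ s′) ⟨
  k * (s₀ + ∑ s′)                                         ∎
  where
  open ≡-Reasoning
  s₀ = s Fin.zero
  s′ = s ∘ Fin.suc
  once-more : ∀ k (t : Fin k → ℕ) → ∑ t + (k ∸ 1) * ∑ t ≡ k * ∑ t
  once-more zero    t = refl
  once-more (suc k) t = refl

opposite-< : ∀ {k} {a b : Fin k} → toℕ a < toℕ b → toℕ (opposite b) < toℕ (opposite a)
opposite-< {k} {a} {b} a<b = subst₂ _<_ (sym (opposite-prop b)) (sym (opposite-prop a)) (∸-monoʳ-< (s≤s a<b) (toℕ<n b))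

opposite-<ᵇ : ∀ {k} (a b : Fin k) → (toℕ (opposite a) <ᵇ toℕ (opposite b)) ≡ (toℕ b <ᵇ toℕ a)
opposite-<ᵇ a b = T-ext
  (λ t → <⇒<ᵇ (subst₂ (λ x y → toℕ x < toℕ y) (opposite-involutive b) (opposite-involutive a)
                 (opposite-< (<ᵇ⇒< (toℕ (opposite a)) (toℕ (opposite b)) t))))
  (λ t → <⇒<ᵇ (opposite-< (<ᵇ⇒< (toℕ b) (toℕ a) t)))

sumOverPairs-opposite : ∀ {k} (Q : Fin k → Fin k → ℕ) →
  sumOverPairs (λ a b → Q (opposite a) (opposite b)) ≡ sumOverPairs (λ a b → Q b a)
sumOverPairs-opposite Q = begin
  ∑ (λ a → ∑ (λ b → G a b))                                   ≡⟨ ∑-opposite (λ a → ∑ (λ b → G a b)) ⟨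
  ∑ (λ a → ∑ (λ b → G (opposite a) b))                        ≡⟨ ∑-cong _ _ (λ a → ∑-opposite (G (opposite a))) ⟨
  ∑ (λ a → ∑ (λ b → G (opposite a) (opposite b)))             ≡⟨ ∑-cong _ _ (λ a → ∑-cong _ _ (reflect a)) ⟩
  ∑ (λ a → ∑ (λ b → if toℕ b <ᵇ toℕ a then Q a b else 0))    ≡⟨ ∑-comm (λ a b → if toℕ b <ᵇ toℕ a then Q a b else 0) ⟩
  ∑ (λ b → ∑ (λ a → if toℕ b <ᵇ toℕ a then Q a b else 0))    ∎
  where
  open ≡-Reasoning
  G = λ a b → if toℕ a <ᵇ toℕ b then Q (opposite a) (opposite b) else 0
  reflect : ∀ a b → G (opposite a) (opposite b) ≡ (if toℕ b <ᵇ toℕ a then Q a b else 0)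
  reflect a b rewrite opposite-<ᵇ a b | opposite-involutive a | opposite-involutive b = refl

coinv≡sumOverPairs : ∀ {k n} (μ : Fin k → Fin n → ℕ) (T : Fin k → Tab n) →
  coinv μ T ≡ sumOverPairs (λ a b → pairCoinv (μ a) (T a) (μ b) (T b))
coinv≡sumOverPairs {k} μ T =
  trans (sum-concatMap _ (allFin k))
  (trans (sumOver-cong (λ a → trans (sum-concatMap _ (allFin k))
                                    (trans (sumOver-cong (λ b → sum-if (toℕ a <ᵇ toℕ b) _) (allFin k)) (sumOver-allFin (guarded a))))
                       (allFin k))
         (sumOver-allFin (λ a → ∑ (guarded a))))
  where
  guarded = λ a b → if toℕ a <ᵇ toℕ b then pairCoinv (μ a) (T a) (μ b) (T b) else 0
  sum-if : ∀ c (xs : List ℕ) → sum (if c then xs else []) ≡ (if c then sum xs else 0)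
  sum-if true  xs = refl
  sum-if false xs = refl

size≡∑∑ : ∀ {k n} (μ : Fin k → Fin n → ℕ) → size μ ≡ ∑ (λ a → ∑ (μ a))
size≡∑∑ {k} {n} μ = trans (sum-concatMap (λ a → map (μ a) (allFin n)) (allFin k))
  (trans (sumOver-cong (λ a → sumOver-allFin (μ a)) (allFin k)) (sumOver-allFin (λ a → ∑ (μ a))))

coinv-identity : ∀ k n N (λs : Fin k → Fin n → ℕ) (T : Fin k → Tab n) →
  (∀ a → IsPartition (λs a)) → (∀ a i → λs a i ≤ N) → (∀ a → IsSSYT (λs a) (T a)) →
  coinv λs T + n * N * (k C 2) ≡ (k ∸ 1) * size λs + coinv (complementShape N λs) (Φ N λs T)
coinv-identity k n N λs T λ-partition λ≤N T-ssyt = begin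
  coinv λs T + n * N * (k C 2)
    ≡⟨ cong₂ _+_ (coinv≡sumOverPairs λs T) (trans (*-comm (n * N) (k C 2)) (sym (sumOverPairs-const k (n * N)))) ⟩
  sumOverPairs P + sumOverPairs {k} (λ _ _ → n * N)
    ≡⟨ sumOverPairs-distrib-+ P (λ _ _ → n * N) ⟨
  sumOverPairs (λ a b → P a b + n * N)
    ≡⟨ sumOverPairs-cong (λ a b → PairIdentity.pair-identity n N (λs a) (λs b) (T a) (T b)
                                    (λ-partition a) (λ-partition b) (T-ssyt a) (T-ssyt b) (λ≤N a) (λ≤N b)) ⟩
  sumOverPairs (λ a b → ∑ (λs a) + ∑ (λs b) + Q b a)
    ≡⟨ sumOverPairs-distrib-+ (λ a b → ∑ (λs a) + ∑ (λs b)) (λ a b → Q b a) ⟩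
  sumOverPairs (λ a b → ∑ (λs a) + ∑ (λs b)) + sumOverPairs (λ a b → Q b a)
    ≡⟨ cong₂ _+_ (sumOverPairs-symmetric k (λ a → ∑ (λs a))) (sym (sumOverPairs-opposite Q)) ⟩
  (k ∸ 1) * ∑ (λ a → ∑ (λs a)) + sumOverPairs (λ a b → Q (opposite a) (opposite b))
    ≡⟨ cong₂ _+_ (cong ((k ∸ 1) *_) (size≡∑∑ λs)) (coinv≡sumOverPairs (complementShape N λs) (Φ N λs T)) ⟨
  (k ∸ 1) * size λs + coinv (complementShape N λs) (Φ N λs T) ∎
  where
  open ≡-Reasoning
  P = λ a b → pairCoinv (λs a) (T a) (λs b) (T b)
  Q = λ a b → pairCoinv (λ i → N ∸ λs a (opposite i)) (Φ₁ N (λs a) (T a)) (λ i → N ∸ λs b (opposite i)) (Φ₁ N (λs b) (T b))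

open import Data.Integer using (ℤ; +_; _-_) renaming (_+_ to _+ℤ_; _*_ to _*ℤ_)
open import Data.Integer.Properties using (pos-*)
import Data.Integer.Tactic.RingSolver as ℤ-Solver

difference-≡ : ∀ A B C X → A + C ≡ X + B → + A - + B ≡ + X - + C
difference-≡ A B C X A+C≡X+B = begin
  + A - + B                     ≡⟨ shift (+ A) (+ B) (+ C) ⟩
  (+ A +ℤ + C) - (+ C +ℤ + B)   ≡⟨ cong (λ z → + z - (+ C +ℤ + B)) A+C≡X+B ⟩
  (+ X +ℤ + B) - (+ C +ℤ + B)   ≡⟨ unshift (+ X) (+ B) (+ C) ⟩
  + X - + C                     ∎
  where
  open ≡-Reasoning
  shift : ∀ x y w → x - y ≡ (x +ℤ w) - (w +ℤ y)
  shift = ℤ-Solver.solve-∀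
  unshift : ∀ z y w → (z +ℤ y) - (w +ℤ y) ≡ z - w
  unshift = ℤ-Solver.solve-∀

-- For k = 0 the family λs is empty, so the truncation in k ∸ 1 is harmless.
size-scaled : ∀ k {n} (λs : Fin k → Fin n → ℕ) → (+ k - + 1) *ℤ (+ size λs) ≡ + ((k ∸ 1) * size λs)
size-scaled zero    λs = refl
size-scaled (suc k) λs = sym (pos-* k (size λs))

lemma6p7 : (k n M : ℕ) (λs : Fin k → Fin n → ℕ)
    → (∀ a → IsPartition (λs a))
    → (∀ a (i : Fin n) → λs a i + n < M + 1)
    → (T : Fin k → Tab n)
    → (∀ a → IsSSYT (λs a) (T a))
    → (+ coinv λs T) - (+ coinv (complementShape (M ∸ n) λs) (Φ (M ∸ n) λs T))
    ≡ ((+ k - + 1) *ℤ (+ size λs)) - (+ (n * (M ∸ n) * (k C 2)))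
lemma6p7 k n M λs λ-partition λ+n<M+1 T T-ssyt =
  trans (difference-≡ _ _ (n * (M ∸ n) * (k C 2)) ((k ∸ 1) * size λs) (coinv-identity k n (M ∸ n) λs T λ-partition λ≤N T-ssyt))
        (cong (_- + (n * (M ∸ n) * (k C 2))) (sym (size-scaled k λs)))
  where
  λ≤N : ∀ a i → λs a i ≤ M ∸ n
  λ≤N a i = m+n≤o⇒m≤o∸n (λs a i) (≤-pred (subst (λs a i + n <_) (+-comm M 1) (λ+n<M+1 a i)))
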